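{- The numbers $b_{n,m,r,\ell}$ can be non-zero only when $n\ge2$, $1\le m\le n-1$, $1\le r\le n-m$ and $1\le \ell\le n-m$. For $n\ge 3$ they satisfy $$b_{n,m,1,\ell}=\sum_{i=1}^{n-m}\sum_{j=0}^{t}b_{n-j-1,m-1,i-j,\ell-j},\qquad m\ge 2,$$ where $t=\min\{i-1,\ell-1\}$, and $$b_{n,m,r,\ell}=b_{n-1,m,r-1,\ell}+\sum_{j=\ell+1}^{n-m}b_{n-1,m-1,r-1,j},\qquad m\ge2,\ r\ge 2,$$ and for $n\ge 2$, $$b_{n,1,r,\ell}=\begin{cases}1,& r+\ell=n,\\ 0,&\text{otherwise.}\end{cases}$$
   Context: An ascent in a sequence $x_1\cdots x_k$ is an index $j$ with $x_j<x_{j+1}$; $\mathrm{asc}(x)$ is the number of ascents. An ascent sequence of length $n$ is a sequence $x_1\cdots x_n$ of non-negative integers with $x_1=0$ and $x_i\le\mathrm{asc}(x_1\cdots x_{i-1})+1$ for $1<i\le n$. A sequence $\pi$ contains a pattern $\tau=\tau_1\cdots\tau_m$ (a sequence of non-negative integers) if there are indices $f(1)<\cdots<f(m)$ such that for all $i,j$: $\pi_{f(i)}<\pi_{f(j)}$ iff $\tau_i<\tau_j$, and $\pi_{f(i)}>\pi_{f(j)}$ iff $\tau_i>\tau_j$; otherwise $\pi$ avoids $\tau$. $\mathcal{S}_{0012}(n)$ is the set of ascent sequences of length $n$ avoiding $0012$. $\mathrm{fwd}(x)$ is the length of the maximal final (contiguous) weakly decreasing segment of $x$. For integers $n,m,r,\ell$,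 $b_{n,m,r,\ell}$ is the number of $\pi\in\mathcal{S}_{0012}(n)$ that do not end in $0$, have exactly $m$ ascents, exactly $r$ zeros, and $\mathrm{fwd}(\pi)=\ell$ (this is $0$ for indices outside the natural range). -}

module Defs where

open import Data.Nat using (ℕ; zero; suc; _+_; _∸_; _⊓_; _<ᵇ_; _≤ᵇ_; _≡ᵇ_)
open import Data.Bool using (Bool; true; false; _∧_; not; if_then_else_)
open import Data.List using (List; []; _∷_; _++_; [_]; length; filter; map; zip; concatMap; upTo; reverse; foldr)
open import Data.Bool.ListAction using (any; all)
open import Data.Nat.ListAction using (sum)
open import Data.Product using (_×_; _,_; proj₁; proj₂)
open import Relation.Nullary.Decidable using (T?)
open import Function using (_∘_)

asc : List ℕ → ℕ
asc (x ∷ y ∷ xs) = (if x <ᵇ y then 1 else 0) + asc (y ∷ xs)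
asc _ = 0

isAscentSeqFrom : List ℕ → List ℕ → Bool
isAscentSeqFrom pre [] = true
isAscentSeqFrom [] (x ∷ rest) = (x ≡ᵇ 0) ∧ isAscentSeqFrom [ x ] rest
isAscentSeqFrom pre@(_ ∷ _) (x ∷ rest) =
  (x ≤ᵇ suc (asc pre)) ∧ isAscentSeqFrom (pre ++ [ x ]) rest

-- an ascent sequence has x_1 = 0, so it is nonempty
isAscentSeq : List ℕ → Bool
isAscentSeq [] = false
isAscentSeq xs@(_ ∷ _) = isAscentSeqFrom [] xs

allLists : ℕ → ℕ → List (List ℕ)
allLists zero bound = [ [] ]
allLists (suc k) bound = concatMap (λ v → map (v ∷_) (allLists k bound)) (upTo bound)

-- ascent sequences of length n (every entry x_i ≤ i - 1 < n, so the search space is complete)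
ascentSeqs : ℕ → List (List ℕ)
ascentSeqs n = filter (T? ∘ isAscentSeq) (allLists n n)

subseqs : List ℕ → List (List ℕ)
subseqs [] = [ [] ]
subseqs (x ∷ xs) = map (x ∷_) (subseqs xs) ++ subseqs xs

_==ᴮ_ : Bool → Bool → Bool
true ==ᴮ b = b
false ==ᴮ b = not b

orderIso : List ℕ → List ℕ → Bool
orderIso s τ = (length s ≡ᵇ length τ) ∧
  all (λ p → all (λ q →
        ((proj₁ p <ᵇ proj₁ q) ==ᴮ (proj₂ p <ᵇ proj₂ q)) ∧
        ((proj₁ q <ᵇ proj₁ p) ==ᴮ (proj₂ q <ᵇ proj₂ p))) ps) ps
  where ps = zip s τ

contains : List ℕ → List ℕ → Bool
contains π τ = any (λ s → orderIso s τ) (subseqs π)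

pat0012 : List ℕ
pat0012 = 0 ∷ 0 ∷ 1 ∷ 2 ∷ []

zeros : List ℕ → ℕ
zeros xs = length (filter (λ x → T? (x ≡ᵇ 0)) xs)

endsInZero : List ℕ → Bool
endsInZero [] = false
endsInZero (x ∷ []) = x ≡ᵇ 0
endsInZero (_ ∷ y ∷ ys) = endsInZero (y ∷ ys)

fwdRev : List ℕ → ℕ
fwdRev [] = 0
fwdRev (y ∷ []) = 1
fwdRev (y ∷ z ∷ ys) = if y ≤ᵇ z then suc (fwdRev (z ∷ ys)) else 1

fwd : List ℕ → ℕ
fwd xs = fwdRev (reverse xs)

countedBy : ℕ → ℕ → ℕ → List ℕ → Bool
countedBy m r ℓ π = not (contains π pat0012) ∧ not (endsInZero π) ∧
  (asc π ≡ᵇ m) ∧ (zeros π ≡ᵇ r) ∧ (fwd π ≡ᵇ ℓ)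

b : ℕ → ℕ → ℕ → ℕ → ℕ
b n m r ℓ = length (filter (T? ∘ countedBy m r ℓ) (ascentSeqs n))

-- Σ_{i=lo}^{hi} f i  (empty, i.e. 0, when hi < lo)
sumFromTo : ℕ → ℕ → (ℕ → ℕ) → ℕ
sumFromTo lo hi f = sum (map (λ k → f (lo + k)) (upTo (suc hi ∸ lo)))

sumBelow : ℕ → (ℕ → ℕ) → ℕ
sumBelow t f = sum (map f (upTo t))

module Submission where

-- A counted sequence starts with 0 and ends in a final weakly decreasing run S of length ℓ = fwd, whose
-- entries are positive since the sequence does not end in 0.
--
-- With a single ascent the sequence is forced to be 0…0 1…1.
--
-- If r = 1, every other entry is positive, so the sequence is 0 followed by τ + 1 for an arbitrary
-- 0012-avoiding ascent sequence τ with m − 1 ascents and fwd τ = ℓ. Sorting these τ by their number i of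
-- zeros, and removing the j final zeros of τ one by one (each removal lowers the length, the number of
-- zeros and fwd by one), gives the double sum.
--
-- If r ≥ 2, the entry just before S must be 0: otherwise two earlier zeros, that entry and the head of S
-- would form a 0012. Deleting this zero is a bijection onto the 0012-avoiding ascent sequences of length
-- n − 1 with r − 1 zeros, not ending in 0, which either still have S as final run and m ascents, or whose
-- final run absorbed the preceding entry, with fwd = j > ℓ and m − 1 ascents.

open import Defs
open import Data.Nat using (ℕ; _+_; _∸_; _⊓_; _≤_)
open import Data.Product using (_×_)
open import Relation.Binary.PropositionalEquality using (_≡_; _≢_)

open import Data.Bool using (Bool; true; false; T; _∧_; if_then_else_)
open import Data.Bool.ListAction using (all)
open import Data.Bool.Properties using (T-∧)
open import Data.Empty using (⊥; ⊥-elim)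
open import Data.List
  using (List; []; _∷_; _++_; [_]; length; filter; map; upTo; concatMap; cartesianProductWith; zip; reverse; replicate;
         take; drop; initLast; _∷ʳ′_)
open import Data.List.Membership.Propositional using (_∈_; find; lose)
open import Data.List.Membership.Propositional.Properties
  using (∈-∃++; ∈-++⁻; ∈-++⁺ˡ; ∈-++⁺ʳ; ∈-filter⁺; ∈-filter⁻; ∈-upTo⁺; ∈-map⁺; ∈-map⁻;
         ∈-cartesianProductWith⁺; ∈-cartesianProductWith⁻)
open import Data.List.Properties
  using (length-++; length-drop; length-map; length-replicate; length-reverse; ++-assoc; ++-identityʳ; ++-conicalˡ; ++-conicalʳ;
         ∷-injective; map-++; map-∘; map-id; map-cong; map-applyUpTo; map-upTo; filter-++; take++drop≡id;
         unfold-reverse; reverse-++; reverse-involutive; reverse-injective)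
open import Data.List.Relation.Binary.Sublist.Propositional using (_⊆_; []; _∷_; _∷ʳ_; lookup; minimum; ⊆-refl; ⊆-trans)
open import Data.List.Relation.Binary.Sublist.Propositional.Properties
  using (∷ˡ⁻) renaming (map⁺ to ⊆-map⁺; ++⁺ to ⊆-++⁺; ++⁺ʳ to ⊆-++⁺ʳ)
open import Data.List.Relation.Unary.All as All using (All; []; _∷_)
open import Data.List.Relation.Unary.All.Properties using (all⁺)
open import Data.List.Relation.Unary.Any using (here; there)
open import Data.List.Relation.Unary.Any.Properties using (any⁺; any⁻)
open import Data.List.Relation.Unary.Linked as Linked using (Linked; []; [-]; _∷_)
import Data.List.Relation.Unary.Linked.Properties as Linked
open import Data.List.Relation.Unary.Unique.Propositional using (Unique; []; _∷_)
import Data.List.Relation.Unary.Unique.Propositional.Properties as Unique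
open import Data.Nat
  using (zero; suc; pred; _<_; _≥_; z≤n; s≤s; z<s; _≟_; _≤?_; _<?_; _<ᵇ_; _≤ᵇ_; _≡ᵇ_)
open import Data.Nat.ListAction using (sum)
open import Data.Nat.Properties
open import Data.Product using (∃; ∃₂; _,_; proj₁; proj₂)
open import Data.Sum as Sum using (_⊎_; inj₁; inj₂; [_,_]′)
open import Data.Unit using (⊤; tt)
open import Function using (_∘_; id; flip; Equivalence)
open import Level using (0ℓ)
open import Relation.Binary using (Rel)
open import Relation.Binary.PropositionalEquality using (refl; sym; trans; cong; cong₂; subst; subst₂; module ≡-Reasoning)
open import Relation.Nullary using (¬_; Dec; yes; no; does)
open import Relation.Nullary.Decidable using (T?; ¬?; _×-dec_; _⊎-dec_; map′)
open import Relation.Nullary.Reflects using (ofʸ; ofⁿ)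
open import Relation.Unary using (Pred; Decidable)

private variable
  A B : Set

count : {P : Pred A 0ℓ} → Decidable P → List A → ℕ
count P? xs = length (filter P? xs)

length-≤-injection : (f : A → B) {xs : List A} {ys : List B} → Unique xs →
  (∀ {x} → x ∈ xs → f x ∈ ys) → (∀ {x y} → x ∈ xs → y ∈ xs → f x ≡ f y → x ≡ y) →
  length xs ≤ length ys
length-≤-injection f {[]} _ _ _ = z≤n
length-≤-injection f {x ∷ xs} {ys} (x∉xs ∷ xs!) into inj
  with ys₁ , ys₂ , refl ← ∈-∃++ (into (here refl)) =
  begin
    suc (length xs)             ≤⟨ s≤s (length-≤-injection f xs! into′ (λ p q → inj (there p) (there q))) ⟩
    suc (length (ys₁ ++ ys₂))   ≡⟨ cong suc (length-++ ys₁) ⟩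
    suc (length ys₁ + length ys₂) ≡⟨ +-suc (length ys₁) (length ys₂) ⟨
    length ys₁ + length (f x ∷ ys₂) ≡⟨ length-++ ys₁ ⟨
    length (ys₁ ++ f x ∷ ys₂)   ∎
  where
  open ≤-Reasoning
  into′ : ∀ {y} → y ∈ xs → f y ∈ ys₁ ++ ys₂
  into′ {y} y∈xs with ∈-++⁻ ys₁ (into (there y∈xs))
  ... | inj₁ p = ∈-++⁺ˡ p
  ... | inj₂ (here fy≡fx) = ⊥-elim (All.lookup x∉xs y∈xs (inj (here refl) (there y∈xs) (sym fy≡fx)))
  ... | inj₂ (there p) = ∈-++⁺ʳ ys₁ p

count-≤-injection : {P : Pred A 0ℓ} {Q : Pred B 0ℓ} (P? : Decidable P) (Q? : Decidable Q)
  {xs : List A} {ys : List B} → Unique xs → (f : A → B) →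
  (∀ {x} → x ∈ xs → P x → f x ∈ ys × Q (f x)) →
  (∀ {x y} → x ∈ xs → P x → y ∈ xs → P y → f x ≡ f y → x ≡ y) →
  count P? xs ≤ count Q? ys
count-≤-injection P? Q? xs! f into inj =
  length-≤-injection f (Unique.filter⁺ P? xs!)
    (λ x∈ → let (x∈xs , px) = ∈-filter⁻ P? x∈ ; (fx∈ys , qfx) = into x∈xs px in ∈-filter⁺ Q? fx∈ys qfx)
    (λ x∈ y∈ → let (x∈xs , px) = ∈-filter⁻ P? x∈ ; (y∈xs , py) = ∈-filter⁻ P? y∈ in inj x∈xs px y∈xs py)

count-bijection : {P : Pred A 0ℓ} {Q : Pred B 0ℓ} (P? : Decidable P) (Q? : Decidable Q)
  {xs : List A} {ys : List B} → Unique xs → Unique ys → (f : A → B) (g : B → A) →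
  (∀ {x} → x ∈ xs → P x → f x ∈ ys × Q (f x)) →
  (∀ {y} → y ∈ ys → Q y → g y ∈ xs × P (g y)) →
  (∀ {x} → x ∈ xs → P x → g (f x) ≡ x) →
  (∀ {y} → y ∈ ys → Q y → f (g y) ≡ y) →
  count P? xs ≡ count Q? ys
count-bijection P? Q? xs! ys! f g f-into g-into gf fg = ≤-antisym
  (count-≤-injection P? Q? xs! f f-into (λ x∈ px y∈ py e → trans (sym (gf x∈ px)) (trans (cong g e) (gf y∈ py))))
  (count-≤-injection Q? P? ys! g g-into (λ x∈ qx y∈ qy e → trans (sym (fg x∈ qx)) (trans (cong f e) (fg y∈ qy))))

count-cong : {P Q : Pred A 0ℓ} (P? : Decidable P) (Q? : Decidable Q) (xs : List A) →
  (∀ {x} → x ∈ xs → P x → Q x) → (∀ {x} → x ∈ xs → Q x → P x) →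
  count P? xs ≡ count Q? xs
count-cong P? Q? [] _ _ = refl
count-cong P? Q? (x ∷ xs) P⇒Q Q⇒P with P? x | Q? x
... | yes _  | yes _  = cong suc (count-cong P? Q? xs (P⇒Q ∘ there) (Q⇒P ∘ there))
... | yes px | no ¬qx = ⊥-elim (¬qx (P⇒Q (here refl) px))
... | no ¬px | yes qx = ⊥-elim (¬px (Q⇒P (here refl) qx))
... | no _   | no _   = count-cong P? Q? xs (P⇒Q ∘ there) (Q⇒P ∘ there)

count-none : {P : Pred A 0ℓ} (P? : Decidable P) (xs : List A) → (∀ {x} → x ∈ xs → ¬ P x) → count P? xs ≡ 0
count-none P? [] _ = refl
count-none P? (x ∷ xs) none with P? x
... | yes px = ⊥-elim (none (here refl) px)
... | no _ = count-none P? xs (none ∘ there)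

count≡1 : {P : Pred A 0ℓ} (P? : Decidable P) {xs : List A} {w : A} → Unique xs → w ∈ xs → P w →
  (∀ {x} → x ∈ xs → P x → x ≡ w) → count P? xs ≡ 1
count≡1 P? {w = w} xs! w∈ pw unique = count-bijection P? (λ _ → yes tt) xs! ([] ∷ []) (λ _ → tt) (λ _ → w)
  (λ _ _ → here refl , tt) (λ _ _ → w∈ , pw) (λ x∈ px → sym (unique x∈ px)) (λ { (here refl) _ → refl })

count≢0⇒∃ : {P : Pred A 0ℓ} (P? : Decidable P) (xs : List A) → count P? xs ≢ 0 → ∃ λ x → x ∈ xs × P x
count≢0⇒∃ P? [] ≢0 = ⊥-elim (≢0 refl)
count≢0⇒∃ P? (x ∷ xs) ≢0 with P? x
... | yes px = x , here refl , px
... | no _ = let (y , y∈ , py) = count≢0⇒∃ P? xs ≢0 in y , there y∈ , py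

count-disjoint-⊎ : {P Q R : Pred A 0ℓ} (P? : Decidable P) (Q? : Decidable Q) (R? : Decidable R) (xs : List A) →
  (∀ {x} → x ∈ xs → R x → P x ⊎ Q x) → (∀ {x} → x ∈ xs → P x → R x) → (∀ {x} → x ∈ xs → Q x → R x) →
  (∀ {x} → x ∈ xs → P x → ¬ Q x) →
  count R? xs ≡ count P? xs + count Q? xs
count-disjoint-⊎ P? Q? R? [] _ _ _ _ = refl
count-disjoint-⊎ P? Q? R? (x ∷ xs) R⇒P⊎Q P⇒R Q⇒R disj
  with ih ← count-disjoint-⊎ P? Q? R? xs (R⇒P⊎Q ∘ there) (P⇒R ∘ there) (Q⇒R ∘ there) (disj ∘ there)
  with P? x | Q? x | R? x
... | yes px | yes qx | _      = ⊥-elim (disj (here refl) px qx)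
... | yes _  | no _   | yes _  = cong suc ih
... | no _   | yes _  | yes _  = trans (cong suc ih) (sym (+-suc _ _))
... | no _   | no _   | no _   = ih
... | yes px | no _   | no ¬rx = ⊥-elim (¬rx (P⇒R (here refl) px))
... | no _   | yes qx | no ¬rx = ⊥-elim (¬rx (Q⇒R (here refl) qx))
... | no ¬px | no ¬qx | yes rx = ⊥-elim ([ ¬px , ¬qx ]′ (R⇒P⊎Q (here refl) rx))

count-does : {P : Pred A 0ℓ} (P? : Decidable P) (xs : List A) → count (T? ∘ does ∘ P?) xs ≡ count P? xs
count-does P? [] = refl
count-does P? (x ∷ xs) with does (P? x)
... | true  = cong suc (count-does P? xs)
... | false = count-does P? xs

sum-upTo-suc : (f : ℕ → ℕ) (t : ℕ) → sum (map f (upTo (suc t))) ≡ f 0 + sum (map (f ∘ suc) (upTo t))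
sum-upTo-suc f t = cong (λ ys → f 0 + sum ys) (trans (map-applyUpTo suc f t) (sym (map-upTo (f ∘ suc) t)))

sum-map-cong : (ks : List ℕ) {f g : ℕ → ℕ} → (∀ k → f k ≡ g k) → sum (map f ks) ≡ sum (map g ks)
sum-map-cong ks f≗g = cong sum (map-cong f≗g ks)

sum-map-zero : ∀ (ks : List ℕ) (f : ℕ → ℕ) → (∀ k → f k ≡ 0) → sum (map f ks) ≡ 0
sum-map-zero [] f _ = refl
sum-map-zero (k ∷ ks) f f≡0 = cong₂ _+_ (f≡0 k) (sum-map-zero ks f f≡0)

module _ {P : Pred A 0ℓ} (P? : Decidable P) (g : A → ℕ) where

  fibre? : ∀ i → Decidable (λ x → P x × g x ≡ i)
  fibre? i x = P? x ×-dec (g x ≟ i)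

  private
    range? : ∀ lo t → Decidable (λ x → P x × lo ≤ g x × g x < lo + t)
    range? lo t x = P? x ×-dec (lo ≤? g x ×-dec g x <? lo + t)

    sum-fibres : ∀ xs lo t → sum (map (λ k → count (fibre? (lo + k)) xs) (upTo t)) ≡ count (range? lo t) xs
    sum-fibres xs lo zero = sym (count-none (range? lo 0) xs
      (λ _ (_ , lo≤ , <lo+0) → <⇒≱ <lo+0 (subst (_≤ _) (sym (+-identityʳ lo)) lo≤)))
    sum-fibres xs lo (suc t) = begin
      sum (map (λ k → count (fibre? (lo + k)) xs) (upTo (suc t)))
        ≡⟨ sum-upTo-suc (λ k → count (fibre? (lo + k)) xs) t ⟩
      count (fibre? (lo + 0)) xs + sum (map (λ k → count (fibre? (lo + suc k)) xs) (upTo t))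
        ≡⟨ cong₂ _+_ (cong (λ i → count (fibre? i) xs) (+-identityʳ lo))
                     (sum-map-cong (upTo t) (λ k → cong (λ i → count (fibre? i) xs) (+-suc lo k))) ⟩
      count (fibre? lo) xs + sum (map (λ k → count (fibre? (suc lo + k)) xs) (upTo t))
        ≡⟨ cong (count (fibre? lo) xs +_) (sum-fibres xs (suc lo) t) ⟩
      count (fibre? lo) xs + count (range? (suc lo) t) xs
        ≡⟨ count-disjoint-⊎ (fibre? lo) (range? (suc lo) t) (range? lo (suc t)) xs split fibre⇒range tail⇒range disjoint ⟨
      count (range? lo (suc t)) xs ∎
      where
      open ≡-Reasoning
      split : ∀ {x} → x ∈ xs → P x × lo ≤ g x × g x < lo + suc t →
              (P x × g x ≡ lo) ⊎ (P x × suc lo ≤ g x × g x < suc lo + t)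
      split {x} _ (px , lo≤ , <top) with m≤n⇒m<n∨m≡n lo≤
      ... | inj₁ lo< = inj₂ (px , lo< , subst (g x <_) (+-suc lo t) <top)
      ... | inj₂ lo≡ = inj₁ (px , sym lo≡)
      fibre⇒range : ∀ {x} → x ∈ xs → P x × g x ≡ lo → P x × lo ≤ g x × g x < lo + suc t
      fibre⇒range _ (px , refl) = px , ≤-refl , m<m+n lo z<s
      tail⇒range : ∀ {x} → x ∈ xs → P x × suc lo ≤ g x × g x < suc lo + t → P x × lo ≤ g x × g x < lo + suc t
      tail⇒range {x} _ (px , lo< , <top) = px , <⇒≤ lo< , subst (g x <_) (sym (+-suc lo t)) <top
      disjoint : ∀ {x} → x ∈ xs → P x × g x ≡ lo → ¬ (P x × suc lo ≤ g x × g x < suc lo + t)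
      disjoint _ (_ , g≡lo) (_ , lo< , _) = <⇒≢ lo< (sym g≡lo)

  count-by-fibres : ∀ xs lo t → (∀ {x} → x ∈ xs → P x → lo ≤ g x × g x < lo + t) →
    count P? xs ≡ sum (map (λ k → count (fibre? (lo + k)) xs) (upTo t))
  count-by-fibres xs lo t in-range = trans
    (count-cong P? (range? lo t) xs (λ x∈ px → px , in-range x∈ px) (λ _ → proj₁))
    (sym (sum-fibres xs lo t))

-- last₀ and head₀ return the junk value 0 on [].
last₀ : List ℕ → ℕ
last₀ [] = 0
last₀ (x ∷ []) = x
last₀ (_ ∷ y ∷ ys) = last₀ (y ∷ ys)

head₀ : List ℕ → ℕ
head₀ [] = 0
head₀ (x ∷ _) = x

last₀-∷ʳ : ∀ xs y → last₀ (xs ++ [ y ]) ≡ y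
last₀-∷ʳ [] y = refl
last₀-∷ʳ (x ∷ []) y = refl
last₀-∷ʳ (x ∷ x′ ∷ xs) y = last₀-∷ʳ (x′ ∷ xs) y

last₀-++ : ∀ P S → S ≢ [] → last₀ (P ++ S) ≡ last₀ S
last₀-++ [] S _ = refl
last₀-++ (x ∷ []) [] S≢[] = ⊥-elim (S≢[] refl)
last₀-++ (x ∷ []) (y ∷ S) _ = refl
last₀-++ (x ∷ x′ ∷ P) S S≢[] = last₀-++ (x′ ∷ P) S S≢[]

head₀-++ : ∀ S T → S ≢ [] → head₀ (S ++ T) ≡ head₀ S
head₀-++ [] T S≢[] = ⊥-elim (S≢[] refl)
head₀-++ (x ∷ S) T _ = refl

last₀-reverse : ∀ xs → last₀ (reverse xs) ≡ head₀ xs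
last₀-reverse [] = refl
last₀-reverse (x ∷ xs) = trans (cong last₀ (unfold-reverse x xs)) (last₀-∷ʳ (reverse xs) x)

head₀-reverse : ∀ xs → head₀ (reverse xs) ≡ last₀ xs
head₀-reverse xs = trans (sym (last₀-reverse (reverse xs))) (cong last₀ (reverse-involutive xs))

last₀-replicate : ∀ n x → last₀ (replicate (suc n) x) ≡ x
last₀-replicate zero x = refl
last₀-replicate (suc n) x = last₀-replicate n x

last₀-map-suc : ∀ x xs → last₀ (map suc (x ∷ xs)) ≡ suc (last₀ (x ∷ xs))
last₀-map-suc x [] = refl
last₀-map-suc x (y ∷ ys) = last₀-map-suc y ys

reverse≢[] : ∀ {xs : List ℕ} → xs ≢ [] → reverse xs ≢ []
reverse≢[] xs≢[] e = xs≢[] (reverse-injective e)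

length-∷ʳ : ∀ (xs : List ℕ) x → length (xs ++ [ x ]) ≡ suc (length xs)
length-∷ʳ xs x = trans (length-++ xs) (+-comm (length xs) 1)

length-insert : ∀ (Q : List ℕ) x S → length (Q ++ x ∷ S) ≡ suc (length (Q ++ S))
length-insert Q x S = trans (length-++ Q) (trans (+-suc (length Q) (length S)) (cong suc (sym (length-++ Q))))

length-prefix : ∀ (Q S : List ℕ) {n ℓ} → length (Q ++ S) ≡ n → length S ≡ ℓ → length Q ≡ n ∸ ℓ
length-prefix Q S len len≡ = trans (sym (m+n∸n≡m (length Q) (length S))) (cong₂ _∸_ (trans (sym (length-++ Q)) len) len≡)

take-length-++ : ∀ (xs ys : List ℕ) → take (length xs) (xs ++ ys) ≡ xs
take-length-++ [] ys = refl
take-length-++ (x ∷ xs) ys = cong (x ∷_) (take-length-++ xs ys)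

drop-length-++ : ∀ (xs ys : List ℕ) → drop (length xs) (xs ++ ys) ≡ ys
drop-length-++ [] ys = refl
drop-length-++ (x ∷ xs) ys = drop-length-++ xs ys

split-at-end : ∀ (xs : List ℕ) k → k ≤ length xs → ∃₂ λ T S → xs ≡ T ++ S × length S ≡ k
split-at-end xs k k≤ = take (length xs ∸ k) xs , drop (length xs ∸ k) xs , sym (take++drop≡id (length xs ∸ k) xs) ,
  trans (length-drop (length xs ∸ k) xs) (m∸[m∸n]≡n k≤)

map-pred-suc : ∀ xs → map pred (map suc xs) ≡ xs
map-pred-suc xs = trans (sym (map-∘ xs)) (map-id xs)

endsInZero⇒last₀≡0 : ∀ π → T (endsInZero π) → last₀ π ≡ 0
endsInZero⇒last₀≡0 (x ∷ []) t = ≡ᵇ⇒≡ x 0 t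
endsInZero⇒last₀≡0 (x ∷ y ∷ ys) t = endsInZero⇒last₀≡0 (y ∷ ys) t

last₀≡0⇒endsInZero : ∀ π → π ≢ [] → last₀ π ≡ 0 → T (endsInZero π)
last₀≡0⇒endsInZero [] π≢[] _ = ⊥-elim (π≢[] refl)
last₀≡0⇒endsInZero (x ∷ []) _ x≡0 = ≡⇒≡ᵇ x 0 x≡0
last₀≡0⇒endsInZero (x ∷ y ∷ ys) _ last≡0 = last₀≡0⇒endsInZero (y ∷ ys) (λ ()) last≡0

¬endsInZero-last₀ : ∀ π π′ → π ≢ [] → last₀ π′ ≡ last₀ π → ¬ T (endsInZero π) → ¬ T (endsInZero π′)
¬endsInZero-last₀ π π′ π≢[] last≡ ¬ends ends′ =
  ¬ends (last₀≡0⇒endsInZero π π≢[] (trans (sym last≡) (endsInZero⇒last₀≡0 π′ ends′)))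

zeros-++ : ∀ xs ys → zeros (xs ++ ys) ≡ zeros xs + zeros ys
zeros-++ xs ys = trans (cong length (filter-++ (λ x → T? (x ≡ᵇ 0)) xs ys)) (length-++ (filter (λ x → T? (x ≡ᵇ 0)) xs))

zeros-positive : ∀ xs → All (1 ≤_) xs → zeros xs ≡ 0
zeros-positive [] _ = refl
zeros-positive (suc _ ∷ xs) (_ ∷ pos) = zeros-positive xs pos

zeros-++-positive : ∀ P S → All (1 ≤_) S → zeros (P ++ S) ≡ zeros P
zeros-++-positive P S pos = trans (zeros-++ P S) (trans (cong (zeros P +_) (zeros-positive S pos)) (+-identityʳ _))

zeros≢0⇒≢[] : ∀ xs → zeros xs ≢ 0 → xs ≢ []
zeros≢0⇒≢[] [] zeros≢0 _ = zeros≢0 refl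
zeros≢0⇒≢[] (_ ∷ _) _ ()

zeros-replicate-0 : ∀ n → zeros (replicate n 0) ≡ n
zeros-replicate-0 zero = refl
zeros-replicate-0 (suc n) = cong suc (zeros-replicate-0 n)

zeros-replicate-1 : ∀ n → zeros (replicate n 1) ≡ 0
zeros-replicate-1 zero = refl
zeros-replicate-1 (suc n) = zeros-replicate-1 n

zeros-map-suc : ∀ xs → zeros (map suc xs) ≡ 0
zeros-map-suc [] = refl
zeros-map-suc (x ∷ xs) = zeros-map-suc xs

zeros≡0⇒map-suc-pred : ∀ xs → zeros xs ≡ 0 → map suc (map pred xs) ≡ xs
zeros≡0⇒map-suc-pred [] _ = refl
zeros≡0⇒map-suc-pred (suc x ∷ xs) zeros≡0 = cong (suc x ∷_) (zeros≡0⇒map-suc-pred xs zeros≡0)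

zeros-∷ʳ0 : ∀ τ → zeros (τ ++ [ 0 ]) ≡ suc (zeros τ)
zeros-∷ʳ0 τ = trans (zeros-++ τ [ 0 ]) (+-comm (zeros τ) 1)

zeros-insert0 : ∀ Q S → zeros (Q ++ 0 ∷ S) ≡ suc (zeros (Q ++ S))
zeros-insert0 Q S = trans (zeros-++ Q (0 ∷ S)) (trans (+-suc (zeros Q) (zeros S)) (cong suc (sym (zeros-++ Q S))))

≥-trans : ∀ {x y z : ℕ} → x ≥ y → y ≥ z → x ≥ z
≥-trans x≥y y≥z = ≤-trans y≥z x≥y

Linked-∷ʳ : ∀ {R : Rel ℕ 0ℓ} {xs y} → Linked R xs → (xs ≡ [] ⊎ R (last₀ xs) y) → Linked R (xs ++ [ y ])
Linked-∷ʳ [] _ = [-]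
Linked-∷ʳ [-] (inj₂ r) = r ∷ [-]
Linked-∷ʳ (r ∷ rs) (inj₂ r′) = r ∷ Linked-∷ʳ rs (inj₂ r′)

Linked-reverse : ∀ {R : Rel ℕ 0ℓ} {xs} → Linked R xs → Linked (flip R) (reverse xs)
Linked-reverse [] = []
Linked-reverse [-] = [-]
Linked-reverse {R} {x ∷ y ∷ ys} (r ∷ rs) rewrite unfold-reverse x (y ∷ ys) =
  Linked-∷ʳ (Linked-reverse rs) (inj₂ (subst (λ z → R x z) (sym (last₀-reverse (y ∷ ys))) r))

Linked-replicate : ∀ {R : Rel ℕ 0ℓ} n {x} → R x x → Linked R (replicate n x)
Linked-replicate zero _ = []
Linked-replicate (suc zero) _ = [-]
Linked-replicate (suc (suc n)) r = r ∷ Linked-replicate (suc n) r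

Linked-++⁻ʳ : ∀ {R : Rel ℕ 0ℓ} P {S} → Linked R (P ++ S) → Linked R S
Linked-++⁻ʳ [] run = run
Linked-++⁻ʳ (_ ∷ P) run = Linked-++⁻ʳ P (Linked.tail run)

Linked≥⇒last₀≤ : ∀ {S} → Linked _≥_ S → All (last₀ S ≤_) S
Linked≥⇒last₀≤ [] = []
Linked≥⇒last₀≤ [-] = ≤-refl ∷ []
Linked≥⇒last₀≤ (x≥y ∷ dec) with below@(last≤y ∷ _) ← Linked≥⇒last₀≤ dec = ≤-trans last≤y x≥y ∷ below

Linked≥-pair : ∀ {c d S} → (c ∷ d ∷ []) ⊆ S → Linked _≥_ S → d ≤ c
Linked≥-pair (_ ∷ʳ sub) dec = Linked≥-pair sub (Linked.tail dec)
Linked≥-pair (refl ∷ sub) dec with _ ∷ below ← Linked.Linked⇒All ≥-trans ≤-refl dec =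
  All.lookup below (lookup sub (here refl))

split-⊆-++ : ∀ xs {ys s} → s ⊆ xs ++ ys → ∃₂ λ (s₁ s₂ : List ℕ) → s ≡ s₁ ++ s₂ × s₁ ⊆ xs × s₂ ⊆ ys
split-⊆-++ [] sub = [] , _ , refl , [] , sub
split-⊆-++ (x ∷ xs) (_ ∷ʳ sub) with s₁ , s₂ , refl , sub₁ , sub₂ ← split-⊆-++ xs sub =
  s₁ , s₂ , refl , x ∷ʳ sub₁ , sub₂
split-⊆-++ (x ∷ xs) (refl ∷ sub) with s₁ , s₂ , refl , sub₁ , sub₂ ← split-⊆-++ xs sub =
  x ∷ s₁ , s₂ , refl , refl ∷ sub₁ , sub₂

⊆-insert : ∀ (Q : List ℕ) x S → Q ++ S ⊆ Q ++ x ∷ S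
⊆-insert [] x S = x ∷ʳ ⊆-refl
⊆-insert (q ∷ Q) x S = refl ∷ ⊆-insert Q x S

⊆-map-suc⁻ : ∀ {s} τ → s ⊆ map suc τ → ∃ λ s′ → s ≡ map suc s′ × s′ ⊆ τ
⊆-map-suc⁻ [] [] = [] , refl , []
⊆-map-suc⁻ (t ∷ τ) (_ ∷ʳ sub) with s′ , refl , sub′ ← ⊆-map-suc⁻ τ sub = s′ , refl , t ∷ʳ sub′
⊆-map-suc⁻ (t ∷ τ) (refl ∷ sub) with s′ , refl , sub′ ← ⊆-map-suc⁻ τ sub = t ∷ s′ , refl , refl ∷ sub′

replicate-0-⊆ : ∀ k xs → k ≤ zeros xs → replicate k 0 ⊆ xs
replicate-0-⊆ zero xs _ = minimum xs
replicate-0-⊆ (suc k) (zero ∷ xs) (s≤s k≤) = refl ∷ replicate-0-⊆ k xs k≤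
replicate-0-⊆ (suc k) (suc x ∷ xs) k≤ = suc x ∷ʳ replicate-0-⊆ (suc k) xs k≤

-- Ascent sequences

-- With this, asc (l ∷ x ∷ xs) reduces to ascAt l x + asc (x ∷ xs).
ascAt : ℕ → ℕ → ℕ
ascAt l x = if l <ᵇ x then 1 else 0

ascAt-< : ∀ {l x} → l < x → ascAt l x ≡ 1
ascAt-< {l} {x} l<x with l <ᵇ x | <ᵇ-reflects-< l x
... | true  | _ = refl
... | false | ofⁿ l≮x = ⊥-elim (l≮x l<x)

ascAt-≥ : ∀ {l x} → x ≤ l → ascAt l x ≡ 0
ascAt-≥ {l} {x} x≤l with l <ᵇ x | <ᵇ-reflects-< l x
... | true  | ofʸ l<x = ⊥-elim (<⇒≱ l<x x≤l)
... | false | _ = refl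

ascAt≤1 : ∀ l x → ascAt l x ≤ 1
ascAt≤1 l x with l <ᵇ x
... | true  = ≤-refl
... | false = z≤n

asc-++ : ∀ p ps q qs → asc (p ∷ ps ++ q ∷ qs) ≡ asc (p ∷ ps) + ascAt (last₀ (p ∷ ps)) q + asc (q ∷ qs)
asc-++ p [] q qs = refl
asc-++ p (r ∷ rs) q qs = begin
  ascAt p r + asc (r ∷ rs ++ q ∷ qs)                                    ≡⟨ cong (ascAt p r +_) (asc-++ r rs q qs) ⟩
  ascAt p r + (asc (r ∷ rs) + ascAt (last₀ (r ∷ rs)) q + asc (q ∷ qs))  ≡⟨ reassoc ⟩
  ascAt p r + asc (r ∷ rs) + ascAt (last₀ (r ∷ rs)) q + asc (q ∷ qs)    ∎
  where
  open ≡-Reasoning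
  reassoc : ascAt p r + (asc (r ∷ rs) + ascAt (last₀ (r ∷ rs)) q + asc (q ∷ qs))
          ≡ ascAt p r + asc (r ∷ rs) + ascAt (last₀ (r ∷ rs)) q + asc (q ∷ qs)
  reassoc = trans (sym (+-assoc (ascAt p r) _ _)) (cong (_+ asc (q ∷ qs)) (sym (+-assoc (ascAt p r) _ _)))

asc-∷ʳ : ∀ p ps x → asc (p ∷ ps ++ [ x ]) ≡ asc (p ∷ ps) + ascAt (last₀ (p ∷ ps)) x
asc-∷ʳ p ps x = trans (asc-++ p ps x []) (+-identityʳ _)

asc-Linked≥ : ∀ {S} → Linked _≥_ S → asc S ≡ 0
asc-Linked≥ [] = refl
asc-Linked≥ [-] = refl
asc-Linked≥ (x≥y ∷ dec) = cong₂ _+_ (ascAt-≥ x≥y) (asc-Linked≥ dec)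

asc≡0⇒last₀≤head : ∀ l xs → asc (l ∷ xs) ≡ 0 → last₀ (l ∷ xs) ≤ l
asc≡0⇒last₀≤head l [] _ = ≤-refl
asc≡0⇒last₀≤head l (x ∷ xs) asc≡0 with l <ᵇ x | <ᵇ-reflects-< l x
... | false | ofⁿ l≮x = ≤-trans (asc≡0⇒last₀≤head x xs asc≡0) (≮⇒≥ l≮x)

asc-∷-≤ : ∀ x ys → asc (x ∷ ys) ≤ suc (asc ys)
asc-∷-≤ x [] = z≤n
asc-∷-≤ x (y ∷ ys) = +-monoˡ-≤ (asc (y ∷ ys)) (ascAt≤1 x y)

asc-++-≤ : ∀ P S → asc (P ++ S) ≤ length P + asc S
asc-++-≤ [] S = ≤-refl
asc-++-≤ (x ∷ P) S = ≤-trans (asc-∷-≤ x (P ++ S)) (s≤s (asc-++-≤ P S))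

asc-map-suc : ∀ xs → asc (map suc xs) ≡ asc xs
asc-map-suc [] = refl
asc-map-suc (x ∷ []) = refl
asc-map-suc (x ∷ y ∷ ys) = cong (ascAt x y +_) (asc-map-suc (y ∷ ys))

-- Every entry after the first is either a zero or the top of at most one ascent.
asc+zeros≤length : ∀ l xs → asc (l ∷ xs) + zeros xs ≤ length xs
asc+zeros≤length l [] = z≤n
asc+zeros≤length l (zero ∷ xs) = ≤-trans (≤-reflexive (+-suc (asc (0 ∷ xs)) (zeros xs))) (s≤s (asc+zeros≤length 0 xs))
asc+zeros≤length l (suc x ∷ xs) = ≤-trans (≤-reflexive (+-assoc (ascAt l (suc x)) (asc (suc x ∷ xs)) (zeros xs)))
  (+-mono-≤ (ascAt≤1 l (suc x)) (asc+zeros≤length (suc x) xs))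

-- xs can follow a prefix of an ascent sequence that has k ascents and ends in l.
AscentTail : ℕ → ℕ → List ℕ → Set
AscentTail k l [] = ⊤
AscentTail k l (x ∷ xs) = x ≤ suc k × AscentTail (k + ascAt l x) x xs

IsAscentSeq : List ℕ → Set
IsAscentSeq [] = ⊥
IsAscentSeq (x ∷ xs) = x ≡ 0 × AscentTail 0 x xs

isAscentSeqFrom⁻ : ∀ p ps ys → T (isAscentSeqFrom (p ∷ ps) ys) → AscentTail (asc (p ∷ ps)) (last₀ (p ∷ ps)) ys
isAscentSeqFrom⁻ p ps [] _ = tt
isAscentSeqFrom⁻ p ps (x ∷ ys) t with x≤ , rest ← Equivalence.to T-∧ t =
  ≤ᵇ⇒≤ x _ x≤ , subst₂ (λ k l → AscentTail k l ys) (asc-∷ʳ p ps x) (last₀-∷ʳ (p ∷ ps) x)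
                  (isAscentSeqFrom⁻ p (ps ++ [ x ]) ys rest)

isAscentSeqFrom⁺ : ∀ p ps ys → AscentTail (asc (p ∷ ps)) (last₀ (p ∷ ps)) ys → T (isAscentSeqFrom (p ∷ ps) ys)
isAscentSeqFrom⁺ p ps [] _ = tt
isAscentSeqFrom⁺ p ps (x ∷ ys) (x≤ , rest) = Equivalence.from T-∧ (≤⇒≤ᵇ x≤ ,
  isAscentSeqFrom⁺ p (ps ++ [ x ]) ys
    (subst₂ (λ k l → AscentTail k l ys) (sym (asc-∷ʳ p ps x)) (sym (last₀-∷ʳ (p ∷ ps) x)) rest))

isAscentSeq⁻ : ∀ π → T (isAscentSeq π) → IsAscentSeq π
isAscentSeq⁻ (x ∷ xs) t with x≡0 , rest ← Equivalence.to T-∧ t = ≡ᵇ⇒≡ x 0 x≡0 , isAscentSeqFrom⁻ x [] xs rest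

isAscentSeq⁺ : ∀ π → IsAscentSeq π → T (isAscentSeq π)
isAscentSeq⁺ (x ∷ xs) (x≡0 , rest) = Equivalence.from T-∧ (≡⇒≡ᵇ x 0 x≡0 , isAscentSeqFrom⁺ x [] xs rest)

AscentTail-bounded : ∀ k l xs → AscentTail k l xs → All (_< suc k + length xs) xs
AscentTail-bounded k l [] _ = []
AscentTail-bounded k l (x ∷ xs) (x≤ , rest) =
  ≤-trans (s≤s x≤) (s≤s (m<m+n k z<s)) ∷
  All.map (λ {y} y< → ≤-trans y< (s≤s (≤-trans (+-monoˡ-≤ (length xs) (+-monoʳ-≤ k (ascAt≤1 l x)))
                                              (≤-reflexive (+-assoc k 1 (length xs))))))
          (AscentTail-bounded (k + ascAt l x) x xs rest)

AscentTail-++⁻ : ∀ k l xs ys → AscentTail k l (xs ++ ys) →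
  AscentTail k l xs × AscentTail (k + asc (l ∷ xs)) (last₀ (l ∷ xs)) ys
AscentTail-++⁻ k l [] ys tail = tt , subst (λ k′ → AscentTail k′ l ys) (sym (+-identityʳ k)) tail
AscentTail-++⁻ k l (x ∷ xs) ys (x≤ , tail) with tail₁ , tail₂ ← AscentTail-++⁻ (k + ascAt l x) x xs ys tail =
  (x≤ , tail₁) , subst (λ k′ → AscentTail k′ (last₀ (x ∷ xs)) ys) (+-assoc k (ascAt l x) _) tail₂

AscentTail-++⁺ : ∀ k l xs ys → AscentTail k l xs → AscentTail (k + asc (l ∷ xs)) (last₀ (l ∷ xs)) ys →
  AscentTail k l (xs ++ ys)
AscentTail-++⁺ k l [] ys _ tail = subst (λ k′ → AscentTail k′ l ys) (+-identityʳ k) tail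
AscentTail-++⁺ k l (x ∷ xs) ys (x≤ , tail₁) tail₂ = x≤ , AscentTail-++⁺ (k + ascAt l x) x xs ys tail₁
  (subst (λ k′ → AscentTail k′ (last₀ (x ∷ xs)) ys) (sym (+-assoc k (ascAt l x) _)) tail₂)

AscentTail-mono : ∀ {k k′} l ys → k ≤ k′ → AscentTail k l ys → AscentTail k′ l ys
AscentTail-mono l [] _ _ = tt
AscentTail-mono l (y ∷ ys) k≤k′ (y≤ , tail) =
  ≤-trans y≤ (s≤s k≤k′) , AscentTail-mono y ys (+-monoˡ-≤ (ascAt l y) k≤k′) tail

AscentTail-≤ : ∀ k l ys → All (_≤ suc k) ys → AscentTail k l ys
AscentTail-≤ k l [] _ = tt
AscentTail-≤ k l (y ∷ ys) (y≤ ∷ ys≤) =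
  y≤ , AscentTail-≤ (k + ascAt l y) y ys (All.map (λ z≤ → ≤-trans z≤ (s≤s (m≤m+n k _))) ys≤)

AscentTail-map-suc⁻ : ∀ k l ys → AscentTail (suc k) (suc l) (map suc ys) → AscentTail k l ys
AscentTail-map-suc⁻ k l [] _ = tt
AscentTail-map-suc⁻ k l (y ∷ ys) (s≤s y≤ , tail) = y≤ , AscentTail-map-suc⁻ (k + ascAt l y) y ys tail

AscentTail-map-suc⁺ : ∀ k l ys → AscentTail k l ys → AscentTail (suc k) (suc l) (map suc ys)
AscentTail-map-suc⁺ k l [] _ = tt
AscentTail-map-suc⁺ k l (y ∷ ys) (y≤ , tail) = s≤s y≤ , AscentTail-map-suc⁺ (k + ascAt l y) y ys tail

IsAscentSeq⇒≢[] : ∀ {π} → IsAscentSeq π → π ≢ []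
IsAscentSeq⇒≢[] ia refl = ia

zeros≥1 : ∀ {π} → IsAscentSeq π → 1 ≤ zeros π
zeros≥1 {0 ∷ _} _ = s≤s z≤n

asc+zeros≤length-ascentSeq : ∀ {π} → IsAscentSeq π → asc π + zeros π ≤ length π
asc+zeros≤length-ascentSeq {0 ∷ xs} _ =
  ≤-trans (≤-reflexive (+-suc (asc (0 ∷ xs)) (zeros xs))) (s≤s (asc+zeros≤length 0 xs))

allLists≡cartesianProduct : ∀ k n → allLists (suc k) n ≡ cartesianProductWith _∷_ (upTo n) (allLists k n)
allLists≡cartesianProduct k n = go (upTo n)
  where
  go : ∀ vs → concatMap (λ v → map (v ∷_) (allLists k n)) vs ≡ cartesianProductWith _∷_ vs (allLists k n)
  go [] = refl
  go (v ∷ vs) = cong (map (v ∷_) (allLists k n) ++_) (go vs)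

∈-allLists⁺ : ∀ k n xs → length xs ≡ k → All (_< n) xs → xs ∈ allLists k n
∈-allLists⁺ zero n [] refl [] = here refl
∈-allLists⁺ (suc k) n (x ∷ xs) refl (x< ∷ xs<) rewrite allLists≡cartesianProduct k n =
  ∈-cartesianProductWith⁺ _∷_ (∈-upTo⁺ x<) (∈-allLists⁺ k n xs refl xs<)

∈-allLists⁻ : ∀ k n xs → xs ∈ allLists k n → length xs ≡ k
∈-allLists⁻ zero n xs (here refl) = refl
∈-allLists⁻ (suc k) n xs xs∈ rewrite allLists≡cartesianProduct k n
  with _ , ys , _ , ys∈ , refl ← ∈-cartesianProductWith⁻ _∷_ (upTo n) (allLists k n) xs∈ =
  cong suc (∈-allLists⁻ k n ys ys∈)

allLists-unique : ∀ k n → Unique (allLists k n)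
allLists-unique zero n = [] ∷ []
allLists-unique (suc k) n rewrite allLists≡cartesianProduct k n =
  Unique.cartesianProductWith⁺ _∷_ ∷-injective (Unique.upTo⁺ n) (allLists-unique k n)

ascentSeqs-unique : ∀ n → Unique (ascentSeqs n)
ascentSeqs-unique n = Unique.filter⁺ (T? ∘ isAscentSeq) (allLists-unique n n)

∈-ascentSeqs⁺ : ∀ {n π} → IsAscentSeq π → length π ≡ n → π ∈ ascentSeqs n
∈-ascentSeqs⁺ {π = x ∷ xs} ia@(refl , rest) refl =
  ∈-filter⁺ (T? ∘ isAscentSeq) (∈-allLists⁺ _ _ (x ∷ xs) refl (z<s ∷ AscentTail-bounded 0 0 xs rest))
            (isAscentSeq⁺ (x ∷ xs) ia)

∈-ascentSeqs⁻ : ∀ n {π} → π ∈ ascentSeqs n → IsAscentSeq π × length π ≡ n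
∈-ascentSeqs⁻ n {π} π∈ with π∈all , t ← ∈-filter⁻ (T? ∘ isAscentSeq) π∈ =
  isAscentSeq⁻ π t , ∈-allLists⁻ n n π π∈all

count-ascentSeqs-bijection : {P Q : Pred (List ℕ) 0ℓ} (P? : Decidable P) (Q? : Decidable Q)
  (n n′ : ℕ) (f g : List ℕ → List ℕ) →
  (∀ π → IsAscentSeq π → length π ≡ n → P π → IsAscentSeq (f π) × length (f π) ≡ n′ × Q (f π)) →
  (∀ τ → IsAscentSeq τ → length τ ≡ n′ → Q τ → IsAscentSeq (g τ) × length (g τ) ≡ n × P (g τ)) →
  (∀ π → IsAscentSeq π → length π ≡ n → P π → g (f π) ≡ π) →
  (∀ τ → IsAscentSeq τ → length τ ≡ n′ → Q τ → f (g τ) ≡ τ) →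
  count P? (ascentSeqs n) ≡ count Q? (ascentSeqs n′)
count-ascentSeqs-bijection P? Q? n n′ f g f-into g-into gf fg =
  count-bijection P? Q? (ascentSeqs-unique n) (ascentSeqs-unique n′) f g
    (λ {π} π∈ pπ → let (ia , len) = ∈-ascentSeqs⁻ n π∈ ; (ia′ , len′ , q) = f-into π ia len pπ in
                    ∈-ascentSeqs⁺ ia′ len′ , q)
    (λ {τ} τ∈ qτ → let (ia , len) = ∈-ascentSeqs⁻ n′ τ∈ ; (ia′ , len′ , p) = g-into τ ia len qτ in
                    ∈-ascentSeqs⁺ ia′ len′ , p)
    (λ {π} π∈ pπ → let (ia , len) = ∈-ascentSeqs⁻ n π∈ in gf π ia len pπ)
    (λ {τ} τ∈ qτ → let (ia , len) = ∈-ascentSeqs⁻ n′ τ∈ in fg τ ia len qτ)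

-- Final weakly decreasing runs

fwdRev≥1 : ∀ y R → 1 ≤ fwdRev (y ∷ R)
fwdRev≥1 y [] = ≤-refl
fwdRev≥1 y (z ∷ R) with y ≤ᵇ z
... | true  = s≤s z≤n
... | false = ≤-refl

fwdRev-run : ∀ {R₁} R₂ → Linked _≤_ R₁ → R₁ ≢ [] → (R₂ ≡ [] ⊎ head₀ R₂ < last₀ R₁) →
  fwdRev (R₁ ++ R₂) ≡ length R₁
fwdRev-run R₂ [] R₁≢[] _ = ⊥-elim (R₁≢[] refl)
fwdRev-run [] [-] _ _ = refl
fwdRev-run {y ∷ []} (p ∷ R₂) [-] _ (inj₂ p<y) with y ≤ᵇ p | ≤ᵇ-reflects-≤ y p
... | true  | ofʸ y≤p = ⊥-elim (<⇒≱ p<y y≤p)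
... | false | _ = refl
fwdRev-run {x ∷ y ∷ ys} R₂ (x≤y ∷ inc) _ stop with x ≤ᵇ y | ≤ᵇ-reflects-≤ x y
... | true  | _ = cong suc (fwdRev-run R₂ inc (λ ()) stop)
... | false | ofⁿ x≰y = ⊥-elim (x≰y x≤y)

fwdRev-≥ : ∀ {R₁} R₂ → Linked _≤_ R₁ → length R₁ ≤ fwdRev (R₁ ++ R₂)
fwdRev-≥ R₂ [] = z≤n
fwdRev-≥ {y ∷ []} R₂ [-] = fwdRev≥1 y R₂
fwdRev-≥ {x ∷ y ∷ ys} R₂ (x≤y ∷ inc) with x ≤ᵇ y | ≤ᵇ-reflects-≤ x y
... | true  | _ = s≤s (fwdRev-≥ R₂ inc)
... | false | ofⁿ x≰y = ⊥-elim (x≰y x≤y)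

fwdRev-split : ∀ R → R ≢ [] →
  ∃₂ λ R₁ R₂ → R ≡ R₁ ++ R₂ × Linked _≤_ R₁ × R₁ ≢ [] × (R₂ ≡ [] ⊎ head₀ R₂ < last₀ R₁)
fwdRev-split [] R≢[] = ⊥-elim (R≢[] refl)
fwdRev-split (y ∷ []) _ = [ y ] , [] , refl , [-] , (λ ()) , inj₁ refl
fwdRev-split (y ∷ z ∷ R) _ with y ≤? z | fwdRev-split (z ∷ R) (λ ())
... | no y≰z | _ = [ y ] , z ∷ R , refl , [-] , (λ ()) , inj₂ (≰⇒> y≰z)
... | yes _ | [] , _ , _ , _ , R₁≢[] , _ = ⊥-elim (R₁≢[] refl)
... | yes y≤z | z ∷ R₁ , R₂ , refl , inc , _ , stop = y ∷ z ∷ R₁ , R₂ , refl , y≤z ∷ inc , (λ ()) , stop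

-- S is the final weakly decreasing run of P ++ S: it cannot be extended to the left.
FinalRun : List ℕ → List ℕ → Set
FinalRun P S = S ≢ [] × Linked _≥_ S × (P ≡ [] ⊎ last₀ P < head₀ S)

fwd-FinalRun : ∀ P S → FinalRun P S → fwd (P ++ S) ≡ length S
fwd-FinalRun P S (S≢[] , dec , stop) = begin
  fwdRev (reverse (P ++ S))        ≡⟨ cong fwdRev (reverse-++ P S) ⟩
  fwdRev (reverse S ++ reverse P)  ≡⟨ fwdRev-run (reverse P) (Linked-reverse dec) (reverse≢[] S≢[]) stop′ ⟩
  length (reverse S)               ≡⟨ length-reverse S ⟩
  length S                         ∎
  where
  open ≡-Reasoning
  stop′ = Sum.map (cong reverse) (subst₂ _<_ (sym (head₀-reverse P)) (sym (last₀-reverse S))) stop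

fwd-≥ : ∀ P S → Linked _≥_ S → length S ≤ fwd (P ++ S)
fwd-≥ P S dec = subst₂ _≤_ (length-reverse S) (cong fwdRev (sym (reverse-++ P S)))
  (fwdRev-≥ (reverse P) (Linked-reverse dec))

FinalRun-split : ∀ π → π ≢ [] → ∃₂ λ P S → π ≡ P ++ S × FinalRun P S
FinalRun-split π π≢[]
  with R₁ , R₂ , eq , inc , R₁≢[] , stop ← fwdRev-split (reverse π) (reverse≢[] π≢[]) =
  reverse R₂ , reverse R₁ , π≡ , reverse≢[] R₁≢[] , Linked-reverse inc ,
  Sum.map (cong reverse) (subst₂ _<_ (sym (last₀-reverse R₂)) (sym (head₀-reverse R₁))) stop
  where
  π≡ : π ≡ reverse R₂ ++ reverse R₁
  π≡ = trans (sym (reverse-involutive π)) (trans (cong reverse eq) (reverse-++ R₁ R₂))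

asc+fwd≤length : ∀ π → π ≢ [] → asc π + fwd π ≤ length π
asc+fwd≤length π π≢[] with P , S , refl , run@(_ , dec , _) ← FinalRun-split π π≢[] = begin
  asc (P ++ S) + fwd (P ++ S)  ≤⟨ +-monoˡ-≤ _ (asc-++-≤ P S) ⟩
  length P + asc S + fwd (P ++ S) ≡⟨ cong₂ (λ a f → length P + a + f) (asc-Linked≥ dec) (fwd-FinalRun P S run) ⟩
  length P + 0 + length S ≡⟨ cong (_+ length S) (+-identityʳ (length P)) ⟩
  length P + length S ≡⟨ length-++ P ⟨
  length (P ++ S) ∎
  where open ≤-Reasoning

fwd≥1 : ∀ π → π ≢ [] → 1 ≤ fwd π
fwd≥1 π π≢[] with P , S , refl , run ← FinalRun-split π π≢[] =
  subst (1 ≤_) (sym (fwd-FinalRun P S run)) (length≥1 (proj₁ run))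
  where
  length≥1 : ∀ {S : List ℕ} → S ≢ [] → 1 ≤ length S
  length≥1 {[]} S≢[] = ⊥-elim (S≢[] refl)
  length≥1 {_ ∷ _} _ = s≤s z≤n

run-positive : ∀ P S → S ≢ [] → Linked _≥_ S → ¬ T (endsInZero (P ++ S)) → All (1 ≤_) S
run-positive P S S≢[] dec ¬ends = All.map (≤-trans (n≢0⇒n>0 last≢0)) (Linked≥⇒last₀≤ dec)
  where
  last≢0 : last₀ S ≢ 0
  last≢0 last≡0 = ¬ends (last₀≡0⇒endsInZero (P ++ S) (S≢[] ∘ ++-conicalʳ P S) (trans (last₀-++ P S S≢[]) last≡0))

-- The pattern 0012

Occurs0012 : List ℕ → Set
Occurs0012 π = ∃ λ a → ∃₂ λ c d → (a ∷ a ∷ c ∷ d ∷ []) ⊆ π × a < c × c < d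

Avoids0012 : List ℕ → Set
Avoids0012 π = ¬ Occurs0012 π

∈-subseqs⁻ : ∀ π {s} → s ∈ subseqs π → s ⊆ π
∈-subseqs⁻ [] (here refl) = []
∈-subseqs⁻ (x ∷ π) s∈ with ∈-++⁻ (map (x ∷_) (subseqs π)) s∈
... | inj₁ s∈′ with _ , s′∈ , refl ← ∈-map⁻ (x ∷_) s∈′ = refl ∷ ∈-subseqs⁻ π s′∈
... | inj₂ s∈′ = x ∷ʳ ∈-subseqs⁻ π s∈′

∈-subseqs⁺ : ∀ {π s} → s ⊆ π → s ∈ subseqs π
∈-subseqs⁺ [] = here refl
∈-subseqs⁺ {x ∷ π} (x ∷ʳ s⊆π) = ∈-++⁺ʳ (map (x ∷_) (subseqs π)) (∈-subseqs⁺ s⊆π)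
∈-subseqs⁺ (refl ∷ s⊆π) = ∈-++⁺ˡ (∈-map⁺ (_ ∷_) (∈-subseqs⁺ s⊆π))

private
  sameOrder : ℕ × ℕ → ℕ × ℕ → Bool
  sameOrder p q = ((proj₁ p <ᵇ proj₁ q) ==ᴮ (proj₂ p <ᵇ proj₂ q))
                ∧ ((proj₁ q <ᵇ proj₁ p) ==ᴮ (proj₂ q <ᵇ proj₂ p))

  orderIso⇒sameOrder : ∀ s τ → T (orderIso s τ) → ∀ {p q} → p ∈ zip s τ → q ∈ zip s τ → T (sameOrder p q)
  orderIso⇒sameOrder s τ iso {p} p∈ q∈ =
    All.lookup (all⁺ (sameOrder p) _ (All.lookup rows p∈)) q∈
    where
    rows : All (λ p → T (all (sameOrder p) (zip s τ))) (zip s τ)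
    rows = all⁺ (λ p → all (sameOrder p) (zip s τ)) _ (proj₂ (Equivalence.to T-∧ iso))

  ==ᴮ-true : ∀ {x} → T (x ==ᴮ true) → T x
  ==ᴮ-true {true} _ = tt

  ==ᴮ-false : ∀ {x} → T (x ==ᴮ false) → ¬ T x
  ==ᴮ-false {false} _ ()

  <ᵇ-≡-true : ∀ {m n} → m < n → (m <ᵇ n) ≡ true
  <ᵇ-≡-true {m} {n} m<n with m <ᵇ n | <ᵇ-reflects-< m n
  ... | true  | _ = refl
  ... | false | ofⁿ m≮n = ⊥-elim (m≮n m<n)

  <ᵇ-≡-false : ∀ {m n} → n ≤ m → (m <ᵇ n) ≡ false
  <ᵇ-≡-false {m} {n} n≤m with m <ᵇ n | <ᵇ-reflects-< m n
  ... | true  | ofʸ m<n = ⊥-elim (<⇒≱ m<n n≤m)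
  ... | false | _ = refl

orderIso-0012⁻ : ∀ s → T (orderIso s pat0012) → ∃ λ a → ∃₂ λ c d → s ≡ a ∷ a ∷ c ∷ d ∷ [] × a < c × c < d
orderIso-0012⁻ (a ∷ a′ ∷ c ∷ d ∷ []) iso = a , c , d , cong (λ x → a ∷ x ∷ c ∷ d ∷ []) (sym a≡a′) , a<c , c<d
  where
  s = a ∷ a′ ∷ c ∷ d ∷ []
  order : ∀ {p q} → p ∈ zip s pat0012 → q ∈ zip s pat0012 → T (sameOrder p q)
  order = orderIso⇒sameOrder s pat0012 iso
  a<c : a < c
  a<c = <ᵇ⇒< a c (==ᴮ-true (proj₁ (Equivalence.to T-∧ (order (here refl) (there (there (here refl)))))))
  c<d : c < d
  c<d = <ᵇ⇒< c d (==ᴮ-true (proj₁ (Equivalence.to T-∧ (order (there (there (here refl))) (there (there (there (here refl))))))))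
  a≡a′ : a ≡ a′
  a≡a′ with a≮a′ , a′≮a ← Equivalence.to T-∧ (order (here refl) (there (here refl))) =
    ≤-antisym (≮⇒≥ (==ᴮ-false a′≮a ∘ <⇒<ᵇ)) (≮⇒≥ (==ᴮ-false a≮a′ ∘ <⇒<ᵇ))

orderIso-0012⁺ : ∀ {a c d} → a < c → c < d → T (orderIso (a ∷ a ∷ c ∷ d ∷ []) pat0012)
orderIso-0012⁺ {a} {c} {d} a<c c<d
  rewrite <ᵇ-≡-false (≤-refl {a}) | <ᵇ-≡-false (≤-refl {c}) | <ᵇ-≡-false (≤-refl {d})
        | <ᵇ-≡-true a<c | <ᵇ-≡-false (<⇒≤ a<c) | <ᵇ-≡-true (<-trans a<c c<d)
        | <ᵇ-≡-false (<⇒≤ (<-trans a<c c<d)) | <ᵇ-≡-true c<d | <ᵇ-≡-false (<⇒≤ c<d) = tt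

contains-0012⁻ : ∀ π → T (contains π pat0012) → Occurs0012 π
contains-0012⁻ π t
  with s , s∈ , iso ← find (any⁻ _ (subseqs π) t)
  with a , c , d , refl , a<c , c<d ← orderIso-0012⁻ s iso = a , c , d , ∈-subseqs⁻ π s∈ , a<c , c<d

contains-0012⁺ : ∀ π → Occurs0012 π → T (contains π pat0012)
contains-0012⁺ π (a , c , d , sub , a<c , c<d) = any⁺ _ (lose (∈-subseqs⁺ sub) (orderIso-0012⁺ a<c c<d))

avoids? : Decidable Avoids0012
avoids? π = ¬? (map′ (contains-0012⁻ π) (contains-0012⁺ π) (T? (contains π pat0012)))

Avoids0012-≤1 : ∀ {π} → All (_≤ 1) π → Avoids0012 π
Avoids0012-≤1 ≤1 (a , c , d , sub , a<c , c<d) =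
  <⇒≱ (≤-trans (s≤s (≤-trans z<s a<c)) c<d) (All.lookup ≤1 (lookup sub (there (there (there (here refl))))))

Counted : ℕ → ℕ → ℕ → List ℕ → Set
Counted m r ℓ π = Avoids0012 π × ¬ T (endsInZero π) × asc π ≡ m × zeros π ≡ r × fwd π ≡ ℓ

counted? : ∀ m r ℓ → Decidable (Counted m r ℓ)
counted? m r ℓ π = avoids? π ×-dec ¬? (T? (endsInZero π)) ×-dec asc π ≟ m ×-dec zeros π ≟ r ×-dec fwd π ≟ ℓ

b≡count : ∀ n m r ℓ → b n m r ℓ ≡ count (counted? m r ℓ) (ascentSeqs n)
b≡count n m r ℓ = count-does (counted? m r ℓ) (ascentSeqs n)

-- The support of b

Counted-bounds : ∀ {π n m r ℓ} → IsAscentSeq π → length π ≡ n → Counted m r ℓ π →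
  2 ≤ n × 1 ≤ m × m ≤ n ∸ 1 × 1 ≤ r × r ≤ n ∸ m × 1 ≤ ℓ × ℓ ≤ n ∸ m
Counted-bounds {0 ∷ []} (refl , _) _ (_ , ¬ends , _) = ⊥-elim (¬ends tt)
Counted-bounds {0 ∷ x ∷ xs} ia@(refl , _) refl (_ , ¬ends , refl , refl , refl) =
  s≤s (s≤s z≤n) , asc≥1 , asc≤ , s≤s z≤n , zeros≤ , fwd≥1 π (λ ()) , fwd≤
  where
  π = 0 ∷ x ∷ xs
  asc≥1 : 1 ≤ asc π
  asc≥1 with asc π in asc≡
  ... | suc _ = s≤s z≤n
  ... | zero = ⊥-elim (¬ends (last₀≡0⇒endsInZero π (λ ())
                 (n≤0⇒n≡0 (asc≡0⇒last₀≤head 0 (x ∷ xs) asc≡))))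
  asc≤ : asc π ≤ length (x ∷ xs)
  asc≤ = m+n≤o⇒m≤o (asc π) (asc+zeros≤length 0 (x ∷ xs))
  zeros≤ : zeros π ≤ length π ∸ asc π
  zeros≤ = m+n≤o⇒m≤o∸n (zeros π) (subst (_≤ length π) (+-comm (asc π) (zeros π)) (asc+zeros≤length-ascentSeq ia))
  fwd≤ : fwd π ≤ length π ∸ asc π
  fwd≤ = m+n≤o⇒m≤o∸n (fwd π) (subst (_≤ length π) (+-comm (asc π) (fwd π)) (asc+fwd≤length π (λ ())))

b-support : ∀ n m r ℓ → b n m r ℓ ≢ 0 →
  2 ≤ n × 1 ≤ m × m ≤ n ∸ 1 × 1 ≤ r × r ≤ n ∸ m × 1 ≤ ℓ × ℓ ≤ n ∸ m
b-support n m r ℓ b≢0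
  with π , π∈ , c ← count≢0⇒∃ (counted? m r ℓ) (ascentSeqs n) (b≢0 ∘ trans (b≡count n m r ℓ))
  with ia , refl ← ∈-ascentSeqs⁻ n π∈ = Counted-bounds ia refl c

-- Sequences with a single ascent

zerosThenOnes : ℕ → ℕ → List ℕ
zerosThenOnes r ℓ = replicate r 0 ++ replicate ℓ 1

zerosThenOnes-≤1 : ∀ r ℓ → All (_≤ 1) (zerosThenOnes r ℓ)
zerosThenOnes-≤1 zero zero = []
zerosThenOnes-≤1 zero (suc ℓ) = ≤-refl ∷ zerosThenOnes-≤1 zero ℓ
zerosThenOnes-≤1 (suc r) ℓ = z≤n ∷ zerosThenOnes-≤1 r ℓ

length-zerosThenOnes : ∀ r ℓ → length (zerosThenOnes r ℓ) ≡ r + ℓ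
length-zerosThenOnes r ℓ = trans (length-++ (replicate r 0)) (cong₂ _+_ (length-replicate r) (length-replicate ℓ))

zerosThenOnes-counted : ∀ r ℓ →
  IsAscentSeq (zerosThenOnes (suc r) (suc ℓ)) × Counted 1 (suc r) (suc ℓ) (zerosThenOnes (suc r) (suc ℓ))
zerosThenOnes-counted r ℓ =
  (refl , tail r) , Avoids0012-≤1 (zerosThenOnes-≤1 (suc r) (suc ℓ)) , ¬ends , ascents , zeros≡ , fwd≡
  where
  π = zerosThenOnes (suc r) (suc ℓ)
  ones : ∀ n → AscentTail 1 1 (replicate n 1)
  ones zero = tt
  ones (suc n) = s≤s z≤n , ones n
  tail : ∀ n → AscentTail 0 0 (replicate n 0 ++ replicate (suc ℓ) 1)
  tail zero = s≤s z≤n , ones ℓ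
  tail (suc n) = z≤n , tail n
  last≡1 : last₀ π ≡ 1
  last≡1 = trans (last₀-++ (replicate (suc r) 0) (replicate (suc ℓ) 1) (λ ())) (last₀-replicate ℓ 1)
  ¬ends : ¬ T (endsInZero π)
  ¬ends ends = 1+n≢0 (trans (sym last≡1) (endsInZero⇒last₀≡0 π ends))
  ascents : asc π ≡ 1
  ascents = begin
    asc π ≡⟨ asc-++ 0 (replicate r 0) 1 (replicate ℓ 1) ⟩
    asc (replicate (suc r) 0) + ascAt (last₀ (replicate (suc r) 0)) 1 + asc (replicate (suc ℓ) 1)
      ≡⟨ cong₂ (λ a l → a + ascAt l 1 + asc (replicate (suc ℓ) 1))
               (asc-Linked≥ (Linked-replicate (suc r) ≤-refl)) (last₀-replicate r 0) ⟩
    1 + asc (replicate (suc ℓ) 1) ≡⟨ cong suc (asc-Linked≥ (Linked-replicate (suc ℓ) ≤-refl)) ⟩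
    1 ∎
    where open ≡-Reasoning
  zeros≡ : zeros π ≡ suc r
  zeros≡ = trans (zeros-++ (replicate (suc r) 0) (replicate (suc ℓ) 1))
    (trans (cong₂ _+_ (zeros-replicate-0 (suc r)) (zeros-replicate-1 (suc ℓ))) (+-identityʳ (suc r)))
  fwd≡ : fwd π ≡ suc ℓ
  fwd≡ = trans (fwd-FinalRun (replicate (suc r) 0) (replicate (suc ℓ) 1)
                  ((λ ()) , Linked-replicate (suc ℓ) ≤-refl , inj₂ (subst (_< 1) (sym (last₀-replicate r 0)) z<s)))
               (length-replicate (suc ℓ))

private
  ones-shape : ∀ ys → asc (1 ∷ ys) ≡ 0 → last₀ (1 ∷ ys) ≢ 0 → ys ≡ replicate (length ys) 1
  ones-shape [] _ _ = refl
  ones-shape (zero ∷ ys) asc≡0 last≢0 =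
    ⊥-elim (last≢0 (n≤0⇒n≡0 (asc≡0⇒last₀≤head 0 ys asc≡0)))
  ones-shape (suc zero ∷ ys) asc≡0 last≢0 = cong (1 ∷_) (ones-shape ys asc≡0 last≢0)

  one-ascent-shape : ∀ xs → AscentTail 0 0 xs → asc (0 ∷ xs) ≡ 1 → last₀ (0 ∷ xs) ≢ 0 →
    ∃₂ λ r ℓ → 0 ∷ xs ≡ zerosThenOnes (suc r) (suc ℓ)
  one-ascent-shape [] _ _ last≢0 = ⊥-elim (last≢0 refl)
  one-ascent-shape (zero ∷ xs) (_ , tail) asc≡1 last≢0
    with r , ℓ , eq ← one-ascent-shape xs tail asc≡1 last≢0 = suc r , ℓ , cong (0 ∷_) eq
  one-ascent-shape (suc zero ∷ xs) _ asc≡1 last≢0 =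
    0 , length xs , cong (λ ys → 0 ∷ 1 ∷ ys) (ones-shape xs (suc-injective asc≡1) last≢0)
  one-ascent-shape (suc (suc _) ∷ _) (s≤s () , _) _ _

Counted-one-ascent : ∀ {π r ℓ} → IsAscentSeq π → Counted 1 (suc r) (suc ℓ) π → π ≡ zerosThenOnes (suc r) (suc ℓ)
Counted-one-ascent {0 ∷ xs} (refl , tail) (_ , ¬ends , asc≡1 , zeros≡ , fwd≡)
  with r′ , ℓ′ , refl ← one-ascent-shape xs tail asc≡1 (¬ends ∘ last₀≡0⇒endsInZero (0 ∷ xs) (λ ()))
  with _ , _ , _ , _ , zeros≡′ , fwd≡′ ← zerosThenOnes-counted r′ ℓ′ =
  cong₂ zerosThenOnes (trans (sym zeros≡′) zeros≡) (trans (sym fwd≡′) fwd≡)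

b-one-ascent : ∀ n r ℓ → 1 ≤ r → 1 ≤ ℓ → (r + ℓ ≡ n → b n 1 r ℓ ≡ 1) × (r + ℓ ≢ n → b n 1 r ℓ ≡ 0)
b-one-ascent n (suc r) (suc ℓ) _ _ = exactly-one , none
  where
  counted : IsAscentSeq (zerosThenOnes (suc r) (suc ℓ)) × Counted 1 (suc r) (suc ℓ) (zerosThenOnes (suc r) (suc ℓ))
  counted = zerosThenOnes-counted r ℓ
  exactly-one : suc r + suc ℓ ≡ n → b n 1 (suc r) (suc ℓ) ≡ 1
  exactly-one refl = trans (b≡count n 1 (suc r) (suc ℓ)) (count≡1 (counted? 1 (suc r) (suc ℓ)) (ascentSeqs-unique n)
    (∈-ascentSeqs⁺ (proj₁ counted) (length-zerosThenOnes (suc r) (suc ℓ))) (proj₂ counted)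
    (λ π∈ c → Counted-one-ascent (proj₁ (∈-ascentSeqs⁻ (suc r + suc ℓ) π∈)) c))
  none : suc r + suc ℓ ≢ n → b n 1 (suc r) (suc ℓ) ≡ 0
  none r+ℓ≢n = trans (b≡count n 1 (suc r) (suc ℓ)) (count-none (counted? 1 (suc r) (suc ℓ)) (ascentSeqs n) λ π∈ c →
    let (ia , len≡) = ∈-ascentSeqs⁻ n π∈ in
    r+ℓ≢n (trans (sym (length-zerosThenOnes (suc r) (suc ℓ))) (trans (cong length (sym (Counted-one-ascent ia c))) len≡)))

-- Sequences with a single zero

shift : List ℕ → List ℕ
shift τ = 0 ∷ map suc τ

IsAscentSeq-shift⁺ : ∀ {τ} → IsAscentSeq τ → IsAscentSeq (shift τ)
IsAscentSeq-shift⁺ {0 ∷ τ} (refl , tail) = refl , s≤s z≤n , AscentTail-map-suc⁺ 0 0 τ tail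

IsAscentSeq-shift⁻ : ∀ {τ} → τ ≢ [] → IsAscentSeq (shift τ) → IsAscentSeq τ
IsAscentSeq-shift⁻ {[]} τ≢[] _ = ⊥-elim (τ≢[] refl)
IsAscentSeq-shift⁻ {0 ∷ τ} _ (refl , _ , tail) = refl , AscentTail-map-suc⁻ 0 0 τ tail
IsAscentSeq-shift⁻ {suc _ ∷ _} _ (refl , s≤s () , _)

asc-shift : ∀ t τ → asc (shift (t ∷ τ)) ≡ suc (asc (t ∷ τ))
asc-shift t τ = cong suc (asc-map-suc (t ∷ τ))

FinalRun-shift : ∀ P S → FinalRun P S → FinalRun (0 ∷ map suc P) (map suc S)
FinalRun-shift P [] (S≢[] , _) = ⊥-elim (S≢[] refl)
FinalRun-shift P (h ∷ S) (_ , dec , stop) = (λ ()) , Linked.map⁺ (Linked.map s≤s dec) , inj₂ (stop′ P stop)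
  where
  stop′ : ∀ P → (P ≡ [] ⊎ last₀ P < h) → last₀ (0 ∷ map suc P) < suc h
  stop′ [] _ = z<s
  stop′ (p ∷ P) (inj₂ p<h) = subst (_< suc h) (sym (last₀-map-suc p P)) (s≤s p<h)

fwd-shift : ∀ τ → τ ≢ [] → fwd (shift τ) ≡ fwd τ
fwd-shift τ τ≢[] with P , S , refl , run ← FinalRun-split τ τ≢[] = begin
  fwd (0 ∷ map suc (P ++ S))          ≡⟨ cong (fwd ∘ (0 ∷_)) (map-++ suc P S) ⟩
  fwd ((0 ∷ map suc P) ++ map suc S)  ≡⟨ fwd-FinalRun (0 ∷ map suc P) (map suc S) (FinalRun-shift P S run) ⟩
  length (map suc S)                  ≡⟨ length-map suc S ⟩
  length S                            ≡⟨ fwd-FinalRun P S run ⟨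
  fwd (P ++ S)                        ∎
  where open ≡-Reasoning

Occurs0012-shift⁻ : ∀ τ → Occurs0012 (shift τ) → Occurs0012 τ
Occurs0012-shift⁻ τ (a , c , d , 0 ∷ʳ sub , a<c , c<d) with ⊆-map-suc⁻ τ sub
... | a′ ∷ _ ∷ c′ ∷ d′ ∷ [] , refl , sub′ = a′ , c′ , d′ , sub′ , ≤-pred a<c , ≤-pred c<d
Occurs0012-shift⁻ τ (a , c , d , refl ∷ sub , a<c , c<d) with ∈-map⁻ suc (lookup sub (here refl))
... | _ , _ , ()

Occurs0012-shift⁺ : ∀ τ → Occurs0012 τ → Occurs0012 (shift τ)
Occurs0012-shift⁺ τ (a , c , d , sub , a<c , c<d) = suc a , suc c , suc d , 0 ∷ʳ ⊆-map⁺ suc sub , s≤s a<c , s≤s c<d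

AvoidsAscFwd : ℕ → ℕ → List ℕ → Set
AvoidsAscFwd m ℓ π = Avoids0012 π × asc π ≡ m × fwd π ≡ ℓ

avoidsAscFwd? : ∀ m ℓ → Decidable (AvoidsAscFwd m ℓ)
avoidsAscFwd? m ℓ π = avoids? π ×-dec asc π ≟ m ×-dec fwd π ≟ ℓ

Counted-shift⁺ : ∀ {M ℓ τ} → IsAscentSeq τ → AvoidsAscFwd M ℓ τ → Counted (suc M) 1 ℓ (shift τ)
Counted-shift⁺ {τ = t ∷ τ′} _ (avoids , asc≡ , fwd≡) =
  avoids ∘ Occurs0012-shift⁻ (t ∷ τ′) , ¬ends , trans (asc-shift t τ′) (cong suc asc≡) ,
  cong suc (zeros-map-suc (t ∷ τ′)) , trans (fwd-shift (t ∷ τ′) (λ ())) fwd≡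
  where
  ¬ends : ¬ T (endsInZero (shift (t ∷ τ′)))
  ¬ends ends with () ← trans (sym (last₀-map-suc t τ′)) (endsInZero⇒last₀≡0 (shift (t ∷ τ′)) ends)

Counted-shift⁻ : ∀ {M ℓ τ} → IsAscentSeq τ → Counted (suc M) 1 ℓ (shift τ) → AvoidsAscFwd M ℓ τ
Counted-shift⁻ {τ = t ∷ τ′} _ (avoids , _ , asc≡ , _ , fwd≡) =
  avoids ∘ Occurs0012-shift⁺ (t ∷ τ′) , suc-injective (trans (sym (asc-shift t τ′)) asc≡) ,
  trans (sym (fwd-shift (t ∷ τ′) (λ ()))) fwd≡

Counted-one-zero⇒shift : ∀ {M ℓ π} → IsAscentSeq π → Counted (suc M) 1 ℓ π → ∃ λ τ → π ≡ shift τ × τ ≢ []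
Counted-one-zero⇒shift {π = 0 ∷ xs} (refl , _) (_ , ¬ends , _ , zeros≡1 , _) =
  map pred xs , cong (0 ∷_) (sym (zeros≡0⇒map-suc-pred xs (suc-injective zeros≡1))) , nonempty xs ¬ends
  where
  nonempty : ∀ xs → ¬ T (endsInZero (0 ∷ xs)) → map pred xs ≢ []
  nonempty [] ¬ends _ = ¬ends tt
  nonempty (_ ∷ _) _ ()

b-one-zero≡count : ∀ N M ℓ → b (suc N) (suc M) 1 ℓ ≡ count (avoidsAscFwd? M ℓ) (ascentSeqs N)
b-one-zero≡count N M ℓ = trans (b≡count (suc N) (suc M) 1 ℓ)
  (count-ascentSeqs-bijection (counted? (suc M) 1 ℓ) (avoidsAscFwd? M ℓ) (suc N) N (map pred ∘ drop 1) shift f-into g-into gf fg)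
  where
  f-into : ∀ π → IsAscentSeq π → length π ≡ suc N → Counted (suc M) 1 ℓ π →
    IsAscentSeq (map pred (drop 1 π)) × length (map pred (drop 1 π)) ≡ N × AvoidsAscFwd M ℓ (map pred (drop 1 π))
  f-into π ia len c with τ , refl , τ≢[] ← Counted-one-zero⇒shift ia c rewrite map-pred-suc τ =
    τ-asc , suc-injective (trans (cong suc (sym (length-map suc τ))) len) , Counted-shift⁻ τ-asc c
    where
    τ-asc : IsAscentSeq τ
    τ-asc = IsAscentSeq-shift⁻ τ≢[] ia
  g-into : ∀ τ → IsAscentSeq τ → length τ ≡ N → AvoidsAscFwd M ℓ τ →
    IsAscentSeq (shift τ) × length (shift τ) ≡ suc N × Counted (suc M) 1 ℓ (shift τ)
  g-into τ ia len a = IsAscentSeq-shift⁺ ia , cong suc (trans (length-map suc τ) len) , Counted-shift⁺ ia a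
  gf : ∀ π → IsAscentSeq π → length π ≡ suc N → Counted (suc M) 1 ℓ π → shift (map pred (drop 1 π)) ≡ π
  gf π ia _ c with τ , refl , _ ← Counted-one-zero⇒shift ia c = cong shift (map-pred-suc τ)
  fg : ∀ τ → IsAscentSeq τ → length τ ≡ N → AvoidsAscFwd M ℓ τ → map pred (drop 1 (shift τ)) ≡ τ
  fg τ _ _ _ = map-pred-suc τ

-- Removing a final zero

IsAscentSeq-∷ʳ0⁺ : ∀ {τ} → IsAscentSeq τ → IsAscentSeq (τ ++ [ 0 ])
IsAscentSeq-∷ʳ0⁺ {x ∷ xs} (x≡0 , tail) = x≡0 , AscentTail-++⁺ 0 x xs [ 0 ] tail (z≤n , tt)

IsAscentSeq-∷ʳ0⁻ : ∀ {τ} → τ ≢ [] → IsAscentSeq (τ ++ [ 0 ]) → IsAscentSeq τ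
IsAscentSeq-∷ʳ0⁻ {[]} τ≢[] _ = ⊥-elim (τ≢[] refl)
IsAscentSeq-∷ʳ0⁻ {x ∷ xs} _ (x≡0 , tail) = x≡0 , proj₁ (AscentTail-++⁻ 0 x xs [ 0 ] tail)

asc-∷ʳ0 : ∀ τ → τ ≢ [] → asc (τ ++ [ 0 ]) ≡ asc τ
asc-∷ʳ0 [] τ≢[] = ⊥-elim (τ≢[] refl)
asc-∷ʳ0 (p ∷ ps) _ = trans (asc-∷ʳ p ps 0) (+-identityʳ _)

fwd-∷ʳ0 : ∀ τ → τ ≢ [] → fwd (τ ++ [ 0 ]) ≡ suc (fwd τ)
fwd-∷ʳ0 τ τ≢[] with P , S , refl , run@(S≢[] , dec , stop) ← FinalRun-split τ τ≢[] = begin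
  fwd ((P ++ S) ++ [ 0 ])  ≡⟨ cong fwd (++-assoc P S [ 0 ]) ⟩
  fwd (P ++ S ++ [ 0 ])    ≡⟨ fwd-FinalRun P (S ++ [ 0 ]) run′ ⟩
  length (S ++ [ 0 ])      ≡⟨ length-∷ʳ S 0 ⟩
  suc (length S)           ≡⟨ cong suc (fwd-FinalRun P S run) ⟨
  suc (fwd (P ++ S))       ∎
  where
  open ≡-Reasoning
  run′ : FinalRun P (S ++ [ 0 ])
  run′ = (λ ()) ∘ ++-conicalʳ S [ 0 ] , Linked-∷ʳ dec (inj₂ z≤n) ,
         Sum.map₂ (subst (last₀ P <_) (sym (head₀-++ S [ 0 ] S≢[]))) stop

Occurs0012-∷ʳ0 : ∀ τ → Occurs0012 (τ ++ [ 0 ]) → Occurs0012 τ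
Occurs0012-∷ʳ0 τ (a , c , d , sub , a<c , c<d) with split-⊆-++ τ {[ 0 ]} sub
... | s₁ , [] , eq , sub₁ , _ = a , c , d , subst (_⊆ τ) (sym (trans eq (++-identityʳ s₁))) sub₁ , a<c , c<d
... | s₁ , _ ∷ _ , eq , _ , refl ∷ [] = ⊥-elim (<⇒≱ (≤-trans (s≤s z≤n) c<d) (≤-reflexive d≡0))
  where
  d≡0 : d ≡ 0
  d≡0 = trans (cong last₀ eq) (last₀-∷ʳ s₁ 0)
... | _ , _ ∷ _ , _ , _ , _ ∷ʳ ()

AvoidsStats : ℕ → ℕ → ℕ → List ℕ → Set
AvoidsStats m r ℓ π = Avoids0012 π × asc π ≡ m × zeros π ≡ r × fwd π ≡ ℓ

avoidsStats? : ∀ m r ℓ → Decidable (AvoidsStats m r ℓ)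
avoidsStats? m r ℓ π = avoids? π ×-dec asc π ≟ m ×-dec zeros π ≟ r ×-dec fwd π ≟ ℓ

AvoidsStats-∷ʳ0⁺ : ∀ {M i ℓ τ} → τ ≢ [] → AvoidsStats M i ℓ τ → AvoidsStats M (suc i) (suc ℓ) (τ ++ [ 0 ])
AvoidsStats-∷ʳ0⁺ {τ = τ} τ≢[] (avoids , asc≡ , zeros≡ , fwd≡) =
  avoids ∘ Occurs0012-∷ʳ0 τ , trans (asc-∷ʳ0 τ τ≢[]) asc≡ , trans (zeros-∷ʳ0 τ) (cong suc zeros≡) ,
  trans (fwd-∷ʳ0 τ τ≢[]) (cong suc fwd≡)

AvoidsStats-∷ʳ0⁻ : ∀ {M i ℓ τ} → τ ≢ [] → AvoidsStats M (suc i) (suc ℓ) (τ ++ [ 0 ]) → AvoidsStats M i ℓ τ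
AvoidsStats-∷ʳ0⁻ {τ = τ} τ≢[] (avoids , asc≡ , zeros≡ , fwd≡) =
  (λ (a , c , d , sub , a<c , c<d) → avoids (a , c , d , ⊆-trans sub (⊆-++⁺ʳ [ 0 ] ⊆-refl) , a<c , c<d)) ,
  trans (sym (asc-∷ʳ0 τ τ≢[])) asc≡ , suc-injective (trans (sym (zeros-∷ʳ0 τ)) zeros≡) ,
  suc-injective (trans (sym (fwd-∷ʳ0 τ τ≢[])) fwd≡)

count-avoidsStats-split : ∀ N M i ℓ →
  count (avoidsStats? M i ℓ) (ascentSeqs N)
    ≡ b N M i ℓ + count (λ π → avoidsStats? M i ℓ π ×-dec T? (endsInZero π)) (ascentSeqs N)
count-avoidsStats-split N M i ℓ = trans
  (count-disjoint-⊎ (counted? M i ℓ) (λ π → avoidsStats? M i ℓ π ×-dec T? (endsInZero π)) (avoidsStats? M i ℓ) (ascentSeqs N)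
    by-ending (λ _ (avoids , _ , stats) → avoids , stats) (λ _ → proj₁) (λ _ (_ , ¬ends , _) (_ , ends) → ¬ends ends))
  (cong (_+ count (λ π → avoidsStats? M i ℓ π ×-dec T? (endsInZero π)) (ascentSeqs N)) (sym (b≡count N M i ℓ)))
  where
  by-ending : ∀ {π} → π ∈ ascentSeqs N → AvoidsStats M i ℓ π →
              Counted M i ℓ π ⊎ (AvoidsStats M i ℓ π × T (endsInZero π))
  by-ending {π} _ s@(avoids , stats) with T? (endsInZero π)
  ... | yes ends = inj₂ (s , ends)
  ... | no ¬ends = inj₁ (avoids , ¬ends , stats)

count-endsInZero-strip : ∀ N M i ℓ → 1 ≤ M →
  count (λ π → avoidsStats? M (suc i) (suc ℓ) π ×-dec T? (endsInZero π)) (ascentSeqs (suc N))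
    ≡ count (avoidsStats? M i ℓ) (ascentSeqs N)
count-endsInZero-strip N M i ℓ M≥1 =
  count-ascentSeqs-bijection (λ π → avoidsStats? M (suc i) (suc ℓ) π ×-dec T? (endsInZero π)) (avoidsStats? M i ℓ)
    (suc N) N (take N) (_++ [ 0 ]) f-into g-into gf fg
  where
  P = λ π → AvoidsStats M (suc i) (suc ℓ) π × T (endsInZero π)
  strip : ∀ π → IsAscentSeq π → length π ≡ suc N → P π → ∃ λ τ → π ≡ τ ++ [ 0 ] × τ ≢ [] × length τ ≡ N
  strip π ia len (s , ends) with initLast π
  ... | [] = ⊥-elim ia
  ... | τ ∷ʳ′ x with refl ← trans (sym (last₀-∷ʳ τ x)) (endsInZero⇒last₀≡0 (τ ++ [ x ]) ends) =
    τ , refl , τ≢[] , suc-injective (trans (sym (length-∷ʳ τ 0)) len)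
    where
    τ≢[] : τ ≢ []
    τ≢[] refl = <⇒≱ M≥1 (≤-reflexive (sym (proj₁ (proj₂ s))))
  f-into : ∀ π → IsAscentSeq π → length π ≡ suc N → P π →
           IsAscentSeq (take N π) × length (take N π) ≡ N × AvoidsStats M i ℓ (take N π)
  f-into π ia len p@(s , _) with τ , refl , τ≢[] , refl ← strip π ia len p rewrite take-length-++ τ [ 0 ] =
    IsAscentSeq-∷ʳ0⁻ τ≢[] ia , refl , AvoidsStats-∷ʳ0⁻ τ≢[] s
  g-into : ∀ τ → IsAscentSeq τ → length τ ≡ N → AvoidsStats M i ℓ τ →
           IsAscentSeq (τ ++ [ 0 ]) × length (τ ++ [ 0 ]) ≡ suc N × P (τ ++ [ 0 ])
  g-into τ ia len s = IsAscentSeq-∷ʳ0⁺ ia , trans (length-∷ʳ τ 0) (cong suc len) ,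
    AvoidsStats-∷ʳ0⁺ τ≢[] s , last₀≡0⇒endsInZero (τ ++ [ 0 ]) (τ≢[] ∘ ++-conicalˡ τ [ 0 ]) (last₀-∷ʳ τ 0)
    where τ≢[] = IsAscentSeq⇒≢[] ia
  gf : ∀ π → IsAscentSeq π → length π ≡ suc N → P π → take N π ++ [ 0 ] ≡ π
  gf π ia len p with τ , refl , _ , refl ← strip π ia len p = cong (_++ [ 0 ]) (take-length-++ τ [ 0 ])
  fg : ∀ τ → IsAscentSeq τ → length τ ≡ N → AvoidsStats M i ℓ τ → take N (τ ++ [ 0 ]) ≡ τ
  fg τ _ refl _ = take-length-++ τ [ 0 ]

count-avoidsStats : ∀ M → 1 ≤ M → ∀ i ℓ N →
  count (avoidsStats? M i ℓ) (ascentSeqs N) ≡ sumBelow (i ⊓ ℓ) (λ j → b (N ∸ j) M (i ∸ j) (ℓ ∸ j))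
count-avoidsStats M _ zero ℓ N = count-none (avoidsStats? M 0 ℓ) (ascentSeqs N)
  (λ π∈ (_ , _ , zeros≡0 , _) → <⇒≱ (zeros≥1 (proj₁ (∈-ascentSeqs⁻ N π∈))) (≤-reflexive zeros≡0))
count-avoidsStats M _ (suc i) zero N = count-none (avoidsStats? M (suc i) 0) (ascentSeqs N)
  (λ π∈ (_ , _ , _ , fwd≡0) →
    <⇒≱ (fwd≥1 _ (IsAscentSeq⇒≢[] (proj₁ (∈-ascentSeqs⁻ N π∈)))) (≤-reflexive fwd≡0))
count-avoidsStats M _ (suc i) (suc ℓ) zero = sym (sum-map-zero (upTo (suc (i ⊓ ℓ))) _ b-empty)
  where
  b-empty : ∀ j → b (0 ∸ j) M (suc i ∸ j) (suc ℓ ∸ j) ≡ 0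
  b-empty zero = refl
  b-empty (suc j) = refl
count-avoidsStats M M≥1 (suc i) (suc ℓ) (suc N) = begin
  count (avoidsStats? M (suc i) (suc ℓ)) (ascentSeqs (suc N))
    ≡⟨ count-avoidsStats-split (suc N) M (suc i) (suc ℓ) ⟩
  b (suc N) M (suc i) (suc ℓ) + count (λ π → avoidsStats? M (suc i) (suc ℓ) π ×-dec T? (endsInZero π)) (ascentSeqs (suc N))
    ≡⟨ cong (b (suc N) M (suc i) (suc ℓ) +_) (count-endsInZero-strip N M i ℓ M≥1) ⟩
  b (suc N) M (suc i) (suc ℓ) + count (avoidsStats? M i ℓ) (ascentSeqs N)
    ≡⟨ cong (b (suc N) M (suc i) (suc ℓ) +_) (count-avoidsStats M M≥1 i ℓ N) ⟩
  b (suc N) M (suc i) (suc ℓ) + sumBelow (i ⊓ ℓ) (λ j → b (N ∸ j) M (i ∸ j) (ℓ ∸ j))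
    ≡⟨ sum-upTo-suc (λ j → b (suc N ∸ j) M (suc i ∸ j) (suc ℓ ∸ j)) (i ⊓ ℓ) ⟨
  sumBelow (suc i ⊓ suc ℓ) (λ j → b (suc N ∸ j) M (suc i ∸ j) (suc ℓ ∸ j)) ∎
  where open ≡-Reasoning

count-avoidsAscFwd-by-zeros : ∀ N M ℓ →
  count (avoidsAscFwd? M ℓ) (ascentSeqs N) ≡ sumFromTo 1 (N ∸ M) (λ i → count (avoidsStats? M i ℓ) (ascentSeqs N))
count-avoidsAscFwd-by-zeros N M ℓ = trans
  (count-by-fibres (avoidsAscFwd? M ℓ) zeros (ascentSeqs N) 1 (N ∸ M) zeros-range)
  (sum-map-cong (upTo (N ∸ M)) λ k →
    count-cong (fibre? (avoidsAscFwd? M ℓ) zeros (1 + k)) (avoidsStats? M (1 + k) ℓ) (ascentSeqs N)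
      (λ _ ((avoids , asc≡ , fwd≡) , zeros≡) → avoids , asc≡ , zeros≡ , fwd≡)
      (λ _ (avoids , asc≡ , zeros≡ , fwd≡) → (avoids , asc≡ , fwd≡) , zeros≡))
  where
  zeros-range : ∀ {π} → π ∈ ascentSeqs N → AvoidsAscFwd M ℓ π → 1 ≤ zeros π × zeros π < 1 + (N ∸ M)
  zeros-range {π} π∈ (_ , refl , _) with ia , refl ← ∈-ascentSeqs⁻ N π∈ =
    zeros≥1 ia ,
    s≤s (m+n≤o⇒m≤o∸n (zeros π) (subst (_≤ length π) (+-comm (asc π) (zeros π)) (asc+zeros≤length-ascentSeq ia)))

b-one-zero : ∀ n m ℓ → 3 ≤ n → 2 ≤ m →
  b n m 1 ℓ ≡ sumFromTo 1 (n ∸ m) (λ i → sumBelow (i ⊓ ℓ) (λ j → b (n ∸ j ∸ 1) (m ∸ 1) (i ∸ j) (ℓ ∸ j)))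
b-one-zero (suc N) (suc (suc M)) ℓ _ _ = begin
  b (suc N) (suc (suc M)) 1 ℓ
    ≡⟨ b-one-zero≡count N (suc M) ℓ ⟩
  count (avoidsAscFwd? (suc M) ℓ) (ascentSeqs N)
    ≡⟨ count-avoidsAscFwd-by-zeros N (suc M) ℓ ⟩
  sumFromTo 1 (N ∸ suc M) (λ i → count (avoidsStats? (suc M) i ℓ) (ascentSeqs N))
    ≡⟨ sum-map-cong (upTo (N ∸ suc M)) (λ k → trans (count-avoidsStats (suc M) (s≤s z≤n) (suc k) ℓ N)
         (sum-map-cong (upTo (suc k ⊓ ℓ)) (λ j →
           cong (λ n′ → b n′ (suc M) (suc k ∸ j) (ℓ ∸ j)) (sym (suc∸∸1 N j))))) ⟩
  sumFromTo 1 (N ∸ suc M) (λ i → sumBelow (i ⊓ ℓ) (λ j → b (suc N ∸ j ∸ 1) (suc M) (i ∸ j) (ℓ ∸ j))) ∎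
  where
  open ≡-Reasoning
  suc∸∸1 : ∀ N j → suc N ∸ j ∸ 1 ≡ N ∸ j
  suc∸∸1 N j = trans (∸-+-assoc (suc N) j 1) (cong (suc N ∸_) (+-comm j 1))
b-one-zero (suc N) (suc zero) ℓ _ (s≤s ())

-- Removing the zero in front of the final run

deleteAt : ℕ → List ℕ → List ℕ
deleteAt k π = take k π ++ drop (suc k) π

insertZeroAt : ℕ → List ℕ → List ℕ
insertZeroAt k τ = take k τ ++ 0 ∷ drop k τ

deleteAt-++ : ∀ Q x S {k} → length Q ≡ k → deleteAt k (Q ++ x ∷ S) ≡ Q ++ S
deleteAt-++ Q x S refl = cong₂ _++_ (take-length-++ Q (x ∷ S)) (drop-suc-length-++ Q)
  where
  drop-suc-length-++ : ∀ Q → drop (suc (length Q)) (Q ++ x ∷ S) ≡ S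
  drop-suc-length-++ [] = refl
  drop-suc-length-++ (_ ∷ Q) = drop-suc-length-++ Q

insertZeroAt-++ : ∀ Q S {k} → length Q ≡ k → insertZeroAt k (Q ++ S) ≡ Q ++ 0 ∷ S
insertZeroAt-++ Q S refl = cong₂ (λ xs ys → xs ++ 0 ∷ ys) (take-length-++ Q S) (drop-length-++ Q S)

private
  through-inserted-zero : ∀ {S a c d} s₁ {s₂} → Linked _≥_ S → a < c → c < d →
    a ∷ a ∷ c ∷ d ∷ [] ≡ s₁ ++ 0 ∷ s₂ → s₂ ⊆ S → ⊥
  through-inserted-zero [] dec _ c<d refl sub = <⇒≱ c<d (Linked≥-pair (∷ˡ⁻ sub) dec)
  through-inserted-zero (_ ∷ []) dec _ c<d refl sub = <⇒≱ c<d (Linked≥-pair sub dec)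
  through-inserted-zero (_ ∷ _ ∷ []) _ () _ refl _
  through-inserted-zero (_ ∷ _ ∷ _ ∷ []) _ _ () refl _
  through-inserted-zero (_ ∷ _ ∷ _ ∷ _ ∷ []) _ _ _ () _
  through-inserted-zero (_ ∷ _ ∷ _ ∷ _ ∷ _ ∷ _) _ _ _ () _

Occurs0012-insert0 : ∀ Q {S} → Linked _≥_ S → Occurs0012 (Q ++ 0 ∷ S) → Occurs0012 (Q ++ S)
Occurs0012-insert0 Q {S} dec (a , c , d , sub , a<c , c<d) with split-⊆-++ Q {0 ∷ S} sub
... | s₁ , s₂ , eq , sub₁ , 0 ∷ʳ sub₂ = a , c , d , subst (_⊆ Q ++ S) (sym eq) (⊆-++⁺ sub₁ sub₂) , a<c , c<d
... | s₁ , _ ∷ _ , eq , _ , refl ∷ sub₂ = ⊥-elim (through-inserted-zero s₁ dec a<c c<d eq sub₂)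

IsAscentSeq-delete0 : ∀ q Qs h Ss → Linked _≥_ (h ∷ Ss) →
  IsAscentSeq (q ∷ Qs ++ 0 ∷ h ∷ Ss) → IsAscentSeq (q ∷ Qs ++ h ∷ Ss)
IsAscentSeq-delete0 q Qs h Ss dec (q≡0 , tail)
  with tailQ , (_ , h≤ , _) ← AscentTail-++⁻ 0 q Qs (0 ∷ h ∷ Ss) tail =
  q≡0 , AscentTail-++⁺ 0 q Qs (h ∷ Ss) tailQ
          (h≤′ , AscentTail-≤ _ h Ss (All.map (λ s≤h → ≤-trans s≤h (≤-trans h≤′ (s≤s (m≤m+n k _)))) below))
  where
  k = asc (q ∷ Qs)
  h≤′ : h ≤ suc k
  h≤′ = subst (λ k′ → h ≤ suc k′) (+-identityʳ k) h≤
  below : All (_≤ h) Ss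
  below = All.tail (Linked.Linked⇒All ≥-trans ≤-refl dec)

IsAscentSeq-insert0 : ∀ q Qs h Ss → 1 ≤ h →
  IsAscentSeq (q ∷ Qs ++ h ∷ Ss) → IsAscentSeq (q ∷ Qs ++ 0 ∷ h ∷ Ss)
IsAscentSeq-insert0 q Qs (suc h) Ss _ (q≡0 , tail) with tailQ , (h≤ , tailS) ← AscentTail-++⁻ 0 q Qs (suc h ∷ Ss) tail =
  q≡0 , AscentTail-++⁺ 0 q Qs (0 ∷ suc h ∷ Ss) tailQ
    (z≤n , subst (λ k′ → suc h ≤ suc k′) (sym (+-identityʳ k)) h≤ ,
     AscentTail-mono (suc h) Ss (≤-trans (+-monoʳ-≤ k (ascAt≤1 (last₀ (q ∷ Qs)) (suc h)))
                                         (≤-reflexive (cong (_+ 1) (sym (+-identityʳ k))))) tailS)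
  where k = asc (q ∷ Qs)

asc-++-run : ∀ q Qs h Ss → Linked _≥_ (h ∷ Ss) → asc (q ∷ Qs ++ h ∷ Ss) ≡ asc (q ∷ Qs) + ascAt (last₀ (q ∷ Qs)) h
asc-++-run q Qs h Ss dec = trans (asc-++ q Qs h Ss) (trans (cong (_ +_) (asc-Linked≥ dec)) (+-identityʳ _))

asc-insert0 : ∀ q Qs h Ss → Linked _≥_ (h ∷ Ss) → 1 ≤ h → asc (q ∷ Qs ++ 0 ∷ h ∷ Ss) ≡ asc (q ∷ Qs) + 1
asc-insert0 q Qs (suc h) Ss dec _ = begin
  asc (q ∷ Qs ++ 0 ∷ suc h ∷ Ss)             ≡⟨ asc-++ q Qs 0 (suc h ∷ Ss) ⟩
  asc (q ∷ Qs) + 0 + (1 + asc (suc h ∷ Ss))  ≡⟨ cong₂ (λ a z → a + (1 + z)) (+-identityʳ _) (asc-Linked≥ dec) ⟩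
  asc (q ∷ Qs) + 1                            ∎
  where open ≡-Reasoning

fwd-insert0 : ∀ Q h Ss → Linked _≥_ (h ∷ Ss) → 1 ≤ h → fwd (Q ++ 0 ∷ h ∷ Ss) ≡ length (h ∷ Ss)
fwd-insert0 Q h Ss dec h≥1 = trans (cong fwd (sym (++-assoc Q [ 0 ] (h ∷ Ss))))
  (fwd-FinalRun (Q ++ [ 0 ]) (h ∷ Ss) ((λ ()) , dec , inj₂ (subst (_< h) (sym (last₀-∷ʳ Q 0)) h≥1)))

fwd-++-run-≥ : ∀ Q {S} → Q ≢ [] → Linked _≥_ S → S ≢ [] → head₀ S ≤ last₀ Q → suc (length S) ≤ fwd (Q ++ S)
fwd-++-run-≥ Q {S} Q≢[] dec S≢[] h≤ with initLast Q
... | [] = ⊥-elim (Q≢[] refl)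
... | I ∷ʳ′ x = subst (λ π → suc (length S) ≤ fwd π) (sym (++-assoc I [ x ] S)) (fwd-≥ I (x ∷ S) (x≥h S dec S≢[] h≤))
  where
  x≥h : ∀ S → Linked _≥_ S → S ≢ [] → head₀ S ≤ last₀ (I ++ [ x ]) → Linked _≥_ (x ∷ S)
  x≥h [] _ S≢[] = ⊥-elim (S≢[] refl)
  x≥h (h ∷ S) dec _ h≤ = subst (h ≤_) (last₀-∷ʳ I x) h≤ ∷ dec

-- Otherwise two zeros of P, its positive last entry and h would form a 0012.
last-before-run≡0 : ∀ P h Ss → Avoids0012 (P ++ h ∷ Ss) → 2 ≤ zeros P → last₀ P < h → last₀ P ≡ 0
last-before-run≡0 P h Ss avoids two-zeros last<h with initLast P
... | [] with () ← two-zeros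
... | I ∷ʳ′ zero = last₀-∷ʳ I 0
... | I ∷ʳ′ suc p = ⊥-elim (avoids (0 , suc p , h , occurrence , z<s , subst (_< h) (last₀-∷ʳ I (suc p)) last<h))
  where
  zeros-I : 2 ≤ zeros I
  zeros-I = subst (2 ≤_) (trans (zeros-++ I [ suc p ]) (+-identityʳ (zeros I))) two-zeros
  occurrence : (0 ∷ 0 ∷ suc p ∷ h ∷ []) ⊆ (I ++ [ suc p ]) ++ h ∷ Ss
  occurrence = subst ((0 ∷ 0 ∷ suc p ∷ h ∷ []) ⊆_) (sym (++-assoc I [ suc p ] (h ∷ Ss)))
    (⊆-++⁺ (replicate-0-⊆ 2 I zeros-I) (refl ∷ refl ∷ minimum Ss))

Counted⇒zero-before-run : ∀ {π M R ℓ} → IsAscentSeq π → Counted (suc M) (suc (suc R)) ℓ π →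
  ∃ λ Q → ∃₂ λ h Ss → π ≡ Q ++ 0 ∷ h ∷ Ss × Q ≢ [] × Linked _≥_ (h ∷ Ss) × 1 ≤ h × length (h ∷ Ss) ≡ ℓ
Counted⇒zero-before-run {π} {R = R} ia (avoids , ¬ends , _ , zeros≡ , fwd≡) with FinalRun-split π (IsAscentSeq⇒≢[] ia)
... | _ , [] , _ , (S≢[] , _) = ⊥-elim (S≢[] refl)
... | P , h ∷ Ss , refl , run@(_ , dec , stop)
  with positive ← run-positive P (h ∷ Ss) (λ ()) dec ¬ends
  with zeros-P ← trans (sym (zeros-++-positive P (h ∷ Ss) positive)) zeros≡
  with initLast P
...   | [] with () ← zeros-P
...   | Q ∷ʳ′ x
  with refl ← trans (sym (last₀-∷ʳ Q x)) (last-before-run≡0 (Q ++ [ x ]) h Ss avoids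
                (subst (2 ≤_) (sym zeros-P) (s≤s (s≤s z≤n))) (Sum.[ (λ ()) ∘ ++-conicalʳ Q [ x ] , id ]′ stop)) =
  Q , h , Ss , ++-assoc Q [ 0 ] (h ∷ Ss) , zeros≢0⇒≢[] Q (λ z → 1+n≢0 (trans (sym zeros-Q) z)) , dec ,
  All.head positive , trans (sym (fwd-FinalRun (Q ++ [ 0 ]) (h ∷ Ss) run)) fwd≡
  where
  zeros-Q : zeros Q ≡ suc R
  zeros-Q = suc-injective (trans (sym (zeros-∷ʳ0 Q)) zeros-P)

long-fwd⇒run-split : ∀ {τ ℓ} → IsAscentSeq τ → ¬ T (endsInZero τ) → 1 ≤ ℓ → ℓ ≤ fwd τ →
  ∃ λ Q → ∃₂ λ h Ss → τ ≡ Q ++ h ∷ Ss × Q ≢ [] × Linked _≥_ (h ∷ Ss) × 1 ≤ h × length (h ∷ Ss) ≡ ℓ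
long-fwd⇒run-split {τ} {ℓ} ia ¬ends ℓ≥1 ℓ≤fwd
  with P , S , refl , run@(_ , dec , _) ← FinalRun-split τ (IsAscentSeq⇒≢[] ia)
  with split-at-end S ℓ (subst (ℓ ≤_) (fwd-FinalRun P S run) ℓ≤fwd)
... | _ , [] , _ , len≡ = ⊥-elim (<⇒≱ ℓ≥1 (≤-reflexive (sym len≡)))
... | S₁ , h ∷ Ss , refl , len≡ =
  P ++ S₁ , h , Ss , τ≡ , Q≢[] , dec′ , All.head positive , len≡
  where
  τ≡ : P ++ S₁ ++ h ∷ Ss ≡ (P ++ S₁) ++ h ∷ Ss
  τ≡ = sym (++-assoc P S₁ (h ∷ Ss))
  dec′ : Linked _≥_ (h ∷ Ss)
  dec′ = Linked-++⁻ʳ S₁ dec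
  positive : All (1 ≤_) (h ∷ Ss)
  positive = run-positive (P ++ S₁) (h ∷ Ss) (λ ()) dec′ (subst (λ π → ¬ T (endsInZero π)) τ≡ ¬ends)
  Q≢[] : P ++ S₁ ≢ []
  Q≢[] Q≡[] = <⇒≱ (zeros≥1 ia)
    (≤-reflexive (trans (cong zeros τ≡) (trans (zeros-++-positive (P ++ S₁) (h ∷ Ss) positive) (cong zeros Q≡[]))))

LongRun : ℕ → ℕ → ℕ → List ℕ → Set
LongRun m r ℓ τ = Avoids0012 τ × ¬ T (endsInZero τ) × asc τ ≡ m × zeros τ ≡ r × ℓ < fwd τ

longRun? : ∀ m r ℓ → Decidable (LongRun m r ℓ)
longRun? m r ℓ τ = avoids? τ ×-dec ¬? (T? (endsInZero τ)) ×-dec asc τ ≟ m ×-dec zeros τ ≟ r ×-dec ℓ <? fwd τ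

-- Deleting a zero in front of the final run either keeps that run and all ascents, or merges the run
-- with the entry before it and loses one ascent.
ZeroDeleted : ℕ → ℕ → ℕ → List ℕ → Set
ZeroDeleted M r ℓ τ = Counted (suc M) r ℓ τ ⊎ LongRun M r ℓ τ

zeroDeleted? : ∀ M r ℓ → Decidable (ZeroDeleted M r ℓ)
zeroDeleted? M r ℓ τ = counted? (suc M) r ℓ τ ⊎-dec longRun? M r ℓ τ

ZeroDeleted⇒Avoids0012 : ∀ {M r ℓ τ} → ZeroDeleted M r ℓ τ → Avoids0012 τ
ZeroDeleted⇒Avoids0012 (inj₁ (avoids , _)) = avoids
ZeroDeleted⇒Avoids0012 (inj₂ (avoids , _)) = avoids

ZeroDeleted⇒¬endsInZero : ∀ {M r ℓ τ} → ZeroDeleted M r ℓ τ → ¬ T (endsInZero τ)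
ZeroDeleted⇒¬endsInZero (inj₁ (_ , ¬ends , _)) = ¬ends
ZeroDeleted⇒¬endsInZero (inj₂ (_ , ¬ends , _)) = ¬ends

ZeroDeleted⇒zeros : ∀ {M r ℓ τ} → ZeroDeleted M r ℓ τ → zeros τ ≡ r
ZeroDeleted⇒zeros (inj₁ (_ , _ , _ , zeros≡ , _)) = zeros≡
ZeroDeleted⇒zeros (inj₂ (_ , _ , _ , zeros≡ , _)) = zeros≡

ZeroDeleted⇒ℓ≤fwd : ∀ {M r ℓ τ} → ZeroDeleted M r ℓ τ → ℓ ≤ fwd τ
ZeroDeleted⇒ℓ≤fwd (inj₁ (_ , _ , _ , _ , fwd≡)) = ≤-reflexive (sym fwd≡)
ZeroDeleted⇒ℓ≤fwd (inj₂ (_ , _ , _ , _ , ℓ<fwd)) = <⇒≤ ℓ<fwd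

Counted-delete0 : ∀ {M R} q Qs h Ss → Linked _≥_ (h ∷ Ss) → 1 ≤ h →
  Counted (suc M) (suc (suc R)) (length (h ∷ Ss)) (q ∷ Qs ++ 0 ∷ h ∷ Ss) →
  ZeroDeleted M (suc R) (length (h ∷ Ss)) (q ∷ Qs ++ h ∷ Ss)
Counted-delete0 {M} {R} q Qs h Ss dec h≥1 (avoids , ¬ends , asc≡ , zeros≡ , _) = by-junction (last₀ Q <? h)
  where
  Q = q ∷ Qs
  S = h ∷ Ss
  avoids′ : Avoids0012 (Q ++ S)
  avoids′ (a , c , d , sub , a<c , c<d) = avoids (a , c , d , ⊆-trans sub (⊆-insert Q 0 S) , a<c , c<d)
  ¬ends′ : ¬ T (endsInZero (Q ++ S))
  ¬ends′ = ¬endsInZero-last₀ (Q ++ 0 ∷ S) (Q ++ S) (λ ())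
             (trans (last₀-++ Q S (λ ())) (sym (last₀-++ Q (0 ∷ S) (λ ())))) ¬ends
  zeros′ : zeros (Q ++ S) ≡ suc R
  zeros′ = suc-injective (trans (sym (zeros-insert0 Q S)) zeros≡)
  asc-Q : asc Q ≡ M
  asc-Q = +-cancelʳ-≡ 1 (asc Q) M (trans (sym (asc-insert0 q Qs h Ss dec h≥1)) (trans asc≡ (+-comm 1 M)))
  by-junction : Dec (last₀ Q < h) → ZeroDeleted M (suc R) (length S) (Q ++ S)
  by-junction (yes last<h) = inj₁ (avoids′ , ¬ends′ ,
    trans (asc-++-run q Qs h Ss dec) (trans (cong₂ _+_ asc-Q (ascAt-< last<h)) (+-comm M 1)) , zeros′ ,
    fwd-FinalRun Q S ((λ ()) , dec , inj₂ last<h))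
  by-junction (no last≮h) = inj₂ (avoids′ , ¬ends′ ,
    trans (asc-++-run q Qs h Ss dec) (trans (cong₂ _+_ asc-Q (ascAt-≥ (≮⇒≥ last≮h))) (+-identityʳ M)) , zeros′ ,
    fwd-++-run-≥ Q (λ ()) dec (λ ()) (≮⇒≥ last≮h))

ZeroDeleted⇒asc-prefix : ∀ {M r} q Qs h Ss → Linked _≥_ (h ∷ Ss) →
  ZeroDeleted M r (length (h ∷ Ss)) (q ∷ Qs ++ h ∷ Ss) → asc (q ∷ Qs) ≡ M
ZeroDeleted⇒asc-prefix {M} q Qs h Ss dec deleted with last₀ (q ∷ Qs) <? h | deleted
... | yes last<h | inj₁ (_ , _ , asc≡ , _) = +-cancelʳ-≡ 1 (asc (q ∷ Qs)) M
  (trans (cong (asc (q ∷ Qs) +_) (sym (ascAt-< last<h))) (trans (sym (asc-++-run q Qs h Ss dec)) (trans asc≡ (+-comm 1 M))))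
... | yes last<h | inj₂ (_ , _ , _ , _ , ℓ<fwd) =
  ⊥-elim (<⇒≢ ℓ<fwd (sym (fwd-FinalRun (q ∷ Qs) (h ∷ Ss) ((λ ()) , dec , inj₂ last<h))))
... | no last≮h | inj₁ (_ , _ , _ , _ , fwd≡) =
  ⊥-elim (<⇒≢ (fwd-++-run-≥ (q ∷ Qs) (λ ()) dec (λ ()) (≮⇒≥ last≮h)) (sym fwd≡))
... | no last≮h | inj₂ (_ , _ , asc≡ , _) =
  trans (sym (+-identityʳ _))
    (trans (cong (asc (q ∷ Qs) +_) (sym (ascAt-≥ (≮⇒≥ last≮h)))) (trans (sym (asc-++-run q Qs h Ss dec)) asc≡))

ZeroDeleted-insert0 : ∀ {M R} q Qs h Ss → Linked _≥_ (h ∷ Ss) → 1 ≤ h →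
  ZeroDeleted M (suc R) (length (h ∷ Ss)) (q ∷ Qs ++ h ∷ Ss) →
  Counted (suc M) (suc (suc R)) (length (h ∷ Ss)) (q ∷ Qs ++ 0 ∷ h ∷ Ss)
ZeroDeleted-insert0 {M} {R} q Qs h Ss dec h≥1 deleted =
  avoids ∘ Occurs0012-insert0 Q dec , ¬ends′ ,
  trans (asc-insert0 q Qs h Ss dec h≥1) (trans (cong (_+ 1) (ZeroDeleted⇒asc-prefix q Qs h Ss dec deleted)) (+-comm M 1)) ,
  trans (zeros-insert0 Q S) (cong suc zeros≡) , fwd-insert0 Q h Ss dec h≥1
  where
  Q = q ∷ Qs
  S = h ∷ Ss
  avoids : Avoids0012 (Q ++ S)
  avoids = ZeroDeleted⇒Avoids0012 deleted
  zeros≡ : zeros (Q ++ S) ≡ suc R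
  zeros≡ = ZeroDeleted⇒zeros deleted
  ¬ends′ : ¬ T (endsInZero (Q ++ 0 ∷ S))
  ¬ends′ = ¬endsInZero-last₀ (Q ++ S) (Q ++ 0 ∷ S) (λ ())
             (trans (last₀-++ Q (0 ∷ S) (λ ())) (sym (last₀-++ Q S (λ ())))) (ZeroDeleted⇒¬endsInZero deleted)

b-many-zeros≡count : ∀ N M R ℓ → 1 ≤ ℓ →
  b (suc N) (suc M) (suc (suc R)) ℓ ≡ count (zeroDeleted? M (suc R) ℓ) (ascentSeqs N)
b-many-zeros≡count N M R ℓ ℓ≥1 = trans (b≡count (suc N) (suc M) (suc (suc R)) ℓ)
  (count-ascentSeqs-bijection (counted? (suc M) (suc (suc R)) ℓ) (zeroDeleted? M (suc R) ℓ) (suc N) N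
    (deleteAt K) (insertZeroAt K) f-into g-into gf fg)
  where
  K = N ∸ ℓ
  f-into : ∀ π → IsAscentSeq π → length π ≡ suc N → Counted (suc M) (suc (suc R)) ℓ π →
    IsAscentSeq (deleteAt K π) × length (deleteAt K π) ≡ N × ZeroDeleted M (suc R) ℓ (deleteAt K π)
  f-into π ia len c with Counted⇒zero-before-run ia c
  ... | [] , _ , _ , _ , Q≢[] , _ = ⊥-elim (Q≢[] refl)
  ... | q ∷ Qs , h , Ss , refl , _ , dec , h≥1 , refl
    rewrite deleteAt-++ (q ∷ Qs) 0 (h ∷ Ss) (length-prefix (q ∷ Qs) (0 ∷ h ∷ Ss) len refl) =
    IsAscentSeq-delete0 q Qs h Ss dec ia , suc-injective (trans (sym (length-insert (q ∷ Qs) 0 (h ∷ Ss))) len) ,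
    Counted-delete0 q Qs h Ss dec h≥1 c
  g-into : ∀ τ → IsAscentSeq τ → length τ ≡ N → ZeroDeleted M (suc R) ℓ τ →
    IsAscentSeq (insertZeroAt K τ) × length (insertZeroAt K τ) ≡ suc N × Counted (suc M) (suc (suc R)) ℓ (insertZeroAt K τ)
  g-into τ ia len d with long-fwd⇒run-split ia (ZeroDeleted⇒¬endsInZero d) ℓ≥1 (ZeroDeleted⇒ℓ≤fwd d)
  ... | [] , _ , _ , _ , Q≢[] , _ = ⊥-elim (Q≢[] refl)
  ... | q ∷ Qs , h , Ss , refl , _ , dec , h≥1 , refl
    rewrite insertZeroAt-++ (q ∷ Qs) (h ∷ Ss) (length-prefix (q ∷ Qs) (h ∷ Ss) len refl) =
    IsAscentSeq-insert0 q Qs h Ss h≥1 ia , trans (length-insert (q ∷ Qs) 0 (h ∷ Ss)) (cong suc len) ,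
    ZeroDeleted-insert0 q Qs h Ss dec h≥1 d
  gf : ∀ π → IsAscentSeq π → length π ≡ suc N → Counted (suc M) (suc (suc R)) ℓ π → insertZeroAt K (deleteAt K π) ≡ π
  gf π ia len c with Q , h , Ss , refl , _ , _ , _ , refl ← Counted⇒zero-before-run ia c =
    trans (cong (insertZeroAt K) (deleteAt-++ Q 0 (h ∷ Ss) |Q|≡K)) (insertZeroAt-++ Q (h ∷ Ss) |Q|≡K)
    where
    |Q|≡K : length Q ≡ K
    |Q|≡K = length-prefix Q (0 ∷ h ∷ Ss) len refl
  fg : ∀ τ → IsAscentSeq τ → length τ ≡ N → ZeroDeleted M (suc R) ℓ τ → deleteAt K (insertZeroAt K τ) ≡ τ
  fg τ ia len d with Q , h , Ss , refl , _ , _ , _ , refl ← long-fwd⇒run-split ia (ZeroDeleted⇒¬endsInZero d) ℓ≥1 (ZeroDeleted⇒ℓ≤fwd d) =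
    trans (cong (deleteAt K) (insertZeroAt-++ Q (h ∷ Ss) |Q|≡K)) (deleteAt-++ Q 0 (h ∷ Ss) |Q|≡K)
    where
    |Q|≡K : length Q ≡ K
    |Q|≡K = length-prefix Q (h ∷ Ss) len refl

count-zeroDeleted : ∀ N M r ℓ →
  count (zeroDeleted? M r ℓ) (ascentSeqs N) ≡ b N (suc M) r ℓ + count (longRun? M r ℓ) (ascentSeqs N)
count-zeroDeleted N M r ℓ = trans
  (count-disjoint-⊎ (counted? (suc M) r ℓ) (longRun? M r ℓ) (zeroDeleted? M r ℓ) (ascentSeqs N)
    (λ _ → id) (λ _ → inj₁) (λ _ → inj₂)
    (λ _ (_ , _ , asc≡ , _) (_ , _ , asc≡′ , _) → 1+n≢n (trans (sym asc≡) asc≡′)))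
  (cong (_+ count (longRun? M r ℓ) (ascentSeqs N)) (sym (b≡count N (suc M) r ℓ)))

count-longRun-by-fwd : ∀ N M r ℓ → count (longRun? M r ℓ) (ascentSeqs N) ≡ sumFromTo (ℓ + 1) (N ∸ M) (λ j → b N M r j)
count-longRun-by-fwd N M r ℓ = trans
  (count-by-fibres (longRun? M r ℓ) fwd (ascentSeqs N) (ℓ + 1) (suc (N ∸ M) ∸ (ℓ + 1)) fwd-range)
  (sum-map-cong (upTo (suc (N ∸ M) ∸ (ℓ + 1))) λ k → trans
    (count-cong (fibre? (longRun? M r ℓ) fwd (ℓ + 1 + k)) (counted? M r (ℓ + 1 + k)) (ascentSeqs N)
      (λ _ ((avoids , ¬ends , asc≡ , zeros≡ , _) , fwd≡) → avoids , ¬ends , asc≡ , zeros≡ , fwd≡)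
      (λ _ (avoids , ¬ends , asc≡ , zeros≡ , fwd≡) →
        (avoids , ¬ends , asc≡ , zeros≡ ,
         subst (ℓ <_) (sym fwd≡) (≤-trans (≤-reflexive (+-comm 1 ℓ)) (m≤m+n (ℓ + 1) k))) , fwd≡))
    (sym (b≡count N M r (ℓ + 1 + k))))
  where
  fwd-range : ∀ {τ} → τ ∈ ascentSeqs N → LongRun M r ℓ τ →
              ℓ + 1 ≤ fwd τ × fwd τ < ℓ + 1 + (suc (N ∸ M) ∸ (ℓ + 1))
  fwd-range {τ} τ∈ (_ , _ , refl , _ , ℓ<fwd) with ia , refl ← ∈-ascentSeqs⁻ N τ∈ =
    ℓ+1≤fwd , subst (fwd τ <_) (sym (m+[n∸m]≡n (≤-trans ℓ+1≤fwd (≤-trans fwd≤ (n≤1+n _))))) (s≤s fwd≤)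
    where
    ℓ+1≤fwd : ℓ + 1 ≤ fwd τ
    ℓ+1≤fwd = subst (_≤ fwd τ) (+-comm 1 ℓ) ℓ<fwd
    fwd≤ : fwd τ ≤ length τ ∸ asc τ
    fwd≤ = m+n≤o⇒m≤o∸n (fwd τ) (subst (_≤ length τ) (+-comm (asc τ) (fwd τ)) (asc+fwd≤length τ (IsAscentSeq⇒≢[] ia)))

b-many-zeros : ∀ n m r ℓ → 3 ≤ n → 2 ≤ m → 2 ≤ r → 1 ≤ ℓ →
  b n m r ℓ ≡ b (n ∸ 1) m (r ∸ 1) ℓ + sumFromTo (ℓ + 1) (n ∸ m) (λ j → b (n ∸ 1) (m ∸ 1) (r ∸ 1) j)
b-many-zeros (suc N) (suc M) (suc (suc R)) ℓ _ _ _ ℓ≥1 = begin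
  b (suc N) (suc M) (suc (suc R)) ℓ
    ≡⟨ b-many-zeros≡count N M R ℓ ℓ≥1 ⟩
  count (zeroDeleted? M (suc R) ℓ) (ascentSeqs N)
    ≡⟨ count-zeroDeleted N M (suc R) ℓ ⟩
  b N (suc M) (suc R) ℓ + count (longRun? M (suc R) ℓ) (ascentSeqs N)
    ≡⟨ cong (b N (suc M) (suc R) ℓ +_) (count-longRun-by-fwd N M (suc R) ℓ) ⟩
  b N (suc M) (suc R) ℓ + sumFromTo (ℓ + 1) (N ∸ M) (λ j → b N M (suc R) j) ∎
  where open ≡-Reasoning
b-many-zeros (suc N) (suc M) (suc zero) ℓ _ _ (s≤s ()) _

lemma1 : (∀ n m r ℓ → b n m r ℓ ≢ 0 →
    2 ≤ n × 1 ≤ m × m ≤ n ∸ 1 × 1 ≤ r × r ≤ n ∸ m × 1 ≤ ℓ × ℓ ≤ n ∸ m)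
    × (∀ n m ℓ → 3 ≤ n → 2 ≤ m →
    b n m 1 ℓ ≡ sumFromTo 1 (n ∸ m) (λ i →
    sumBelow (i ⊓ ℓ) (λ j → b (n ∸ j ∸ 1) (m ∸ 1) (i ∸ j) (ℓ ∸ j))))
    × (∀ n m r ℓ → 3 ≤ n → 2 ≤ m → 2 ≤ r → 1 ≤ ℓ →
    b n m r ℓ ≡ b (n ∸ 1) m (r ∸ 1) ℓ
    + sumFromTo (ℓ + 1) (n ∸ m) (λ j → b (n ∸ 1) (m ∸ 1) (r ∸ 1) j))
    × (∀ n r ℓ → 2 ≤ n → 1 ≤ r → 1 ≤ ℓ →
    (r + ℓ ≡ n → b n 1 r ℓ ≡ 1) × (r + ℓ ≢ n → b n 1 r ℓ ≡ 0))
lemma1 = b-support , b-one-zero , b-many-zeros , λ n r ℓ _ → b-one-ascent n r ℓ
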